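{- Let $G$ be a chordal graph with perfect elimination order $v_1,\ldots,v_n$, and for $0\le m\le n$ let $G_m$ be the subgraph of $G$ induced by $v_1,\ldots,v_m$. Then the matrix $S_G=\left[{G_m \brace k}\right]_{m,k=0}^n$ is totally non-negative.
   Context: A graph is chordal if it contains no induced cycle of length four or more. An ordering $v_1,\ldots,v_n$ of the vertices is a perfect elimination order if for each $m$ the neighbours of $v_m$ among $v_1,\ldots,v_{m-1}$ form a clique. For a graph $H$ and integer $k$, ${H \brace k}$ is the number of partitions of the vertex set of $H$ into $k$ non-empty independent sets. A matrix is totally non-negative if all its minors are non-negative. -}

module Defs where

open import Data.Nat as ℕ using (ℕ; zero; suc)
open import Data.Fin using (Fin; zero; suc; toℕ; inject≤; punchIn; _<_; _<?_)
open import Data.Fin.Properties using (toℕ≤pred[n]; _≟_; all?; any?)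
open import Data.Integer as ℤ using (ℤ; +_; -_; _*_; _+_)
open import Data.List using (List; []; _∷_; length; filter; concatMap; map)
open import Data.List.Base using (allFin)
open import Data.Product using (Σ; ∃; _×_; _,_)
open import Relation.Nullary using (¬_; Dec)
open import Relation.Nullary.Decidable using (_×-dec_; _→-dec_; ¬?)
open import Relation.Binary.PropositionalEquality using (_≡_)
import Data.Vec.Functional as VF

record SimpleGraph (n : ℕ) : Set₁ where
  field
    Adj    : Fin n → Fin n → Set
    adj?   : ∀ u v → Dec (Adj u v)
    sym    : ∀ {u v} → Adj u v → Adj v u
    irrefl : ∀ {u} → ¬ Adj u u
open SimpleGraph public

-- The natural order zero, 1, ..., n-1 of Fin n is a perfect elimination
-- order: for every vertex a, its neighbours among the earlier vertices
-- form a clique.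
IsPerfectEliminationOrder : ∀ {n} → SimpleGraph n → Set
IsPerfectEliminationOrder {n} G =
  ∀ (a b c : Fin n) → b < a → c < a → ¬ (b ≡ c) →
    Adj G a b → Adj G a c → Adj G b c

inducedPrefix : ∀ {n} → SimpleGraph n → (m : ℕ) → .(m ℕ.≤ n) → SimpleGraph m
inducedPrefix G m p = record
  { Adj    = λ a b → Adj G (inject≤ a p) (inject≤ b p)
  ; adj?   = λ a b → adj? G (inject≤ a p) (inject≤ b p)
  ; sym    = sym G
  ; irrefl = irrefl G
  }

G[_] : ∀ {n} → SimpleGraph n → (m : Fin (suc n)) → SimpleGraph (toℕ m)
G[_] {n} G m = inducedPrefix G (toℕ m) (toℕ≤pred[n] m)

-- A partition into k (unlabelled) blocks is encoded canonically by the
-- labelling f : Fin m → Fin k of its blocks in order of their least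
-- element (restricted growth function):
--   * every label is used             (blocks non-empty, exactly k blocks)
--   * adjacent vertices get different labels (blocks independent)
--   * labels appear in increasing order of first occurrence
--     (every label smaller than f i already occurs before i).

IsIndepPartition : ∀ {m} (H : SimpleGraph m) (k : ℕ) → (Fin m → Fin k) → Set
IsIndepPartition {m} H k f =
  (∀ (c : Fin k) → ∃ λ (i : Fin m) → f i ≡ c) ×
  (∀ (i j : Fin m) → Adj H i j → ¬ (f i ≡ f j)) ×
  (∀ (i : Fin m) (c : Fin k) → c < f i → ∃ λ (j : Fin m) → j < i × f j ≡ c)

isIndepPartition? : ∀ {m} (H : SimpleGraph m) (k : ℕ) (f : Fin m → Fin k) →
                    Dec (IsIndepPartition H k f)
isIndepPartition? H k f =
  all? (λ c → any? (λ i → f i ≟ c)) ×-dec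
  (all? (λ i → all? (λ j → adj? H i j →-dec ¬? (f i ≟ f j))) ×-dec
   all? (λ i → all? (λ c → (c <? f i) →-dec any? (λ j → (j <? i) ×-dec (f j ≟ c)))))

allFuns : (m k : ℕ) → List (Fin m → Fin k)
allFuns zero    k = (λ ()) ∷ []
allFuns (suc m) k = concatMap (λ c → map (λ f → c VF.∷ f) (allFuns m k)) (allFin k)

stirlingG : ∀ {m} → SimpleGraph m → ℕ → ℕ
stirlingG {m} H k = length (filter (isIndepPartition? H k) (allFuns m k))

sumFin : ∀ {n} → (Fin n → ℤ) → ℤ
sumFin {zero}  f = + 0
sumFin {suc n} f = f zero + sumFin (λ j → f (suc j))

sign : ℕ → ℤ
sign zero    = + 1
sign (suc k) = - sign k

det : ∀ {n} → (Fin n → Fin n → ℤ) → ℤ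
det {zero}  A = + 1
det {suc n} A =
  sumFin (λ j → sign (toℕ j) * (A zero j * det (λ a b → A (suc a) (punchIn j b))))

StrictlyIncreasing : ∀ {r N} → (Fin r → Fin N) → Set
StrictlyIncreasing {r} ρ = ∀ (a b : Fin r) → a < b → ρ a < ρ b

TotallyNonNegative : ∀ {N M} → (Fin N → Fin M → ℤ) → Set
TotallyNonNegative {N} {M} A =
  ∀ (r : ℕ) (ρ : Fin r → Fin N) (σ : Fin r → Fin M) →
    StrictlyIncreasing ρ → StrictlyIncreasing σ →
    + 0 ℤ.≤ det (λ a b → A (ρ a) (σ b))

stirlingMatrix : ∀ {n} → SimpleGraph n → Fin (suc n) → Fin (suc n) → ℤ
stirlingMatrix G m k = + stirlingG (G[ G ] m) (toℕ k)

-- Adding the vertices in perfect elimination order, the earlier neighbours of each new vertex form a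
-- clique, of size c_m say, so in a partition into independent sets they lie in c_m distinct blocks;
-- hence {G_{m+1}, k} = {G_m, k-1} + (k - c_m) {G_m, k}: the new vertex opens a block of its own or joins
-- one of the k - c_m blocks free of its neighbours.  Since the steps of this recurrence commute, the
-- matrix it defines for a sequence c arises from the one for c ∘ suc by A ↦ (1 ⊕ A) U, with U upper
-- bidiagonal with ones above the diagonal (k - c_0)_k.  When that diagonal is non-negative the step
-- preserves total non-negativity: expanding a minor column by column writes it as a non-negative
-- combination of minors of A, the other terms having two equal adjacent columns.  The diagonals stay
-- non-negative as long as each c_i is ≤ 0 or at most one more than an earlier c_j, and clique sizes
-- satisfy this because the earlier neighbours of v_i other than the latest one, v_j, are earlier
-- neighbours of v_j.

{-# OPTIONS --safe #-}
module Submission where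

open import Defs renaming (sym to adj-sym)
open import Data.Nat as ℕ using (ℕ; zero; suc)
import Data.Nat.Properties as ℕP
open import Data.Fin as Fin using (Fin; zero; suc; toℕ; punchIn; punchOut; inject₁; inject≤; fromℕ; fromℕ<)
import Data.Fin.Properties as FinP
open import Data.Integer as ℤ using (ℤ; +_; -_; _-_; -[1+_])
import Data.Integer.Properties as ℤP
open import Data.Integer.Tactic.RingSolver using (solve-∀)
import Algebra.Properties.Semiring.Sum as SemiringSum
import Data.Vec.Functional as VF
open import Data.Vec.Functional.Properties using (updateAt-updates; updateAt-minimal)
open import Data.List using (List; []; _∷_; _++_; length; filter; map; concatMap; tabulate)
import Data.List.Properties as ListP
open import Data.Product using (Σ; ∃; _×_; _,_; proj₁; proj₂)
open import Data.Sum using (_⊎_; inj₁; inj₂; [_,_])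
open import Data.Empty using (⊥-elim)
open import Function using (_∘_; id; const)
open import Relation.Nullary using (¬_; Dec; yes; no)
open import Relation.Nullary.Decidable using (_×-dec_; _→-dec_; ¬?)
open import Relation.Unary using (Decidable)
open import Relation.Binary.PropositionalEquality
  using (_≡_; _≢_; refl; sym; trans; cong; cong₂; subst; subst₂; module ≡-Reasoning)

module Determinant where

  open import Data.Integer using (_+_; _*_)

  module ℤΣ = SemiringSum ℤP.+-*-semiring

  Matrix : ℕ → Set
  Matrix n = Fin n → Fin n → ℤ

  sumFin≡sum : ∀ {n} (f : Fin n → ℤ) → sumFin f ≡ ℤΣ.sum f
  sumFin≡sum {zero}  f = refl
  sumFin≡sum {suc n} f = cong (λ s → f zero + s) (sumFin≡sum (λ j → f (suc j)))

  sumFin-cong : ∀ {n} {f g : Fin n → ℤ} → (∀ j → f j ≡ g j) → sumFin f ≡ sumFin g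
  sumFin-cong {zero}  f≗g = refl
  sumFin-cong {suc n} f≗g = cong₂ _+_ (f≗g zero) (sumFin-cong (λ j → f≗g (suc j)))

  sumFin-zero : ∀ {n} (f : Fin n → ℤ) → (∀ j → f j ≡ + 0) → sumFin f ≡ + 0
  sumFin-zero {zero}  f f≗0 = refl
  sumFin-zero {suc n} f f≗0 =
    cong₂ _+_ (f≗0 zero) (sumFin-zero (λ j → f (suc j)) (λ j → f≗0 (suc j)))

  sumFin-linear : ∀ {n} (x y : ℤ) (f g h : Fin n → ℤ) → (∀ j → h j ≡ x * f j + y * g j) →
                  sumFin h ≡ x * sumFin f + y * sumFin g
  sumFin-linear x y f g h h≗ = begin
    sumFin h  ≡⟨ sumFin≡sum h ⟩
    ℤΣ.sum h  ≡⟨ ℤΣ.sum-cong-≗ h≗ ⟩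
    ℤΣ.sum (λ j → x * f j + y * g j)
      ≡⟨ ℤΣ.∑-distrib-+ (VF.map (x *_) f) (VF.map (y *_) g) ⟩
    ℤΣ.sum (VF.map (x *_) f) + ℤΣ.sum (VF.map (y *_) g)
      ≡⟨ sym (cong₂ _+_ (ℤΣ.*-distribˡ-sum x f) (ℤΣ.*-distribˡ-sum y g)) ⟩
    x * ℤΣ.sum f + y * ℤΣ.sum g
      ≡⟨ sym (cong₂ (λ u v → x * u + y * v) (sumFin≡sum f) (sumFin≡sum g)) ⟩
    x * sumFin f + y * sumFin g
      ∎
    where open ≡-Reasoning

  det-cong : ∀ {n} {A B : Matrix n} → (∀ a b → A a b ≡ B a b) → det A ≡ det B
  det-cong {zero}  A≗B = refl
  det-cong {suc n} A≗B = sumFin-cong λ j →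
    cong₂ (λ u v → sign (toℕ j) * (u * v)) (A≗B zero j) (det-cong (λ a b → A≗B (suc a) (punchIn j b)))

  minor : ∀ {n} → Matrix (suc n) → Fin (suc n) → Matrix n
  minor M j a b = M (suc a) (punchIn j b)

  laplaceTerm : ∀ {n} → Matrix (suc n) → Fin (suc n) → ℤ
  laplaceTerm M j = sign (toℕ j) * (M zero j * det (minor M j))

  det-linear-column : ∀ {n} (b : Fin n) (x y : ℤ) (M₁ M₂ M : Matrix n) →
    (∀ a j → j ≢ b → M₁ a j ≡ M a j) → (∀ a j → j ≢ b → M₂ a j ≡ M a j) →
    (∀ a → M a b ≡ x * M₁ a b + y * M₂ a b) → det M ≡ x * det M₁ + y * det M₂
  det-linear-column {suc n} b x y M₁ M₂ M M₁≈M M₂≈M col = sumFin-linear x y _ _ _ term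
    where
    linear-in-entry : ∀ s x y u v d → s * ((x * u + y * v) * d) ≡ x * (s * (u * d)) + y * (s * (v * d))
    linear-in-entry = solve-∀
    linear-in-minor : ∀ s x y u d₁ d₂ → s * (u * (x * d₁ + y * d₂)) ≡ x * (s * (u * d₁)) + y * (s * (u * d₂))
    linear-in-minor = solve-∀
    punchIn≢b : ∀ {j c} (j≢b : j ≢ b) → c ≢ punchOut j≢b → punchIn j c ≢ b
    punchIn≢b {j} j≢b c≢ eq = c≢ (FinP.punchIn-injective j _ _ (trans eq (sym (FinP.punchIn-punchOut j≢b))))
    term : ∀ j → laplaceTerm M j ≡ x * laplaceTerm M₁ j + y * laplaceTerm M₂ j
    term j with j FinP.≟ b
    ... | yes refl
      rewrite col zero
            | det-cong {A = minor M₁ j} (λ a c → M₁≈M (suc a) (punchIn j c) (FinP.punchInᵢ≢i j c))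
            | det-cong {A = minor M₂ j} (λ a c → M₂≈M (suc a) (punchIn j c) (FinP.punchInᵢ≢i j c))
      = linear-in-entry (sign (toℕ j)) x y (M₁ zero j) (M₂ zero j) (det (minor M j))
    ... | no j≢b
      rewrite M₁≈M zero j j≢b | M₂≈M zero j j≢b
            | det-linear-column (punchOut j≢b) x y (minor M₁ j) (minor M₂ j) (minor M j)
                (λ a c → M₁≈M (suc a) (punchIn j c) ∘ punchIn≢b j≢b)
                (λ a c → M₂≈M (suc a) (punchIn j c) ∘ punchIn≢b j≢b)
                (λ a → subst (λ z → M (suc a) z ≡ x * M₁ (suc a) z + y * M₂ (suc a) z)
                             (sym (FinP.punchIn-punchOut j≢b)) (col (suc a)))
      = linear-in-minor (sign (toℕ j)) x y (M zero j) (det (minor M₁ j)) (det (minor M₂ j))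

  Consecutive : ∀ {n} → Fin n → Fin n → Set
  Consecutive p q = toℕ q ≡ suc (toℕ p)

  punchIn-cases : ∀ {n} (i : Fin (suc n)) (e : Fin n) →
    (toℕ e ℕ.< toℕ i × toℕ (punchIn i e) ≡ toℕ e) ⊎ (toℕ i ℕ.≤ toℕ e × toℕ (punchIn i e) ≡ suc (toℕ e))
  punchIn-cases zero    e       = inj₂ (ℕ.z≤n , refl)
  punchIn-cases (suc i) zero    = inj₁ (ℕ.s≤s ℕ.z≤n , refl)
  punchIn-cases (suc i) (suc e) with punchIn-cases i e
  ... | inj₁ (e<i , eq) = inj₁ (ℕ.s≤s e<i , cong suc eq)
  ... | inj₂ (i≤e , eq) = inj₂ (ℕ.s≤s i≤e , cong suc eq)

  punchIn-consecutive : ∀ {n} {p q : Fin (suc n)} → Consecutive p q → ∀ e →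
    punchIn p e ≡ punchIn q e ⊎ (punchIn p e ≡ q × punchIn q e ≡ p)
  punchIn-consecutive {p = p} {q} q≡1+p e with punchIn-cases p e | punchIn-cases q e
  ... | inj₁ (_ , eq₁) | inj₁ (_ , eq₂) = inj₁ (FinP.toℕ-injective (trans eq₁ (sym eq₂)))
  ... | inj₂ (_ , eq₁) | inj₂ (_ , eq₂) = inj₁ (FinP.toℕ-injective (trans eq₁ (sym eq₂)))
  ... | inj₁ (e<p , _) | inj₂ (q≤e , _) = ⊥-elim (ℕP.<-asym e<p (subst (ℕ._≤ toℕ e) q≡1+p q≤e))
  ... | inj₂ (p≤e , eq₁) | inj₁ (e<q , eq₂) =
    inj₂ ( FinP.toℕ-injective (trans eq₁ (trans (cong suc e≡p) (sym q≡1+p)))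
         , FinP.toℕ-injective (trans eq₂ e≡p))
    where
    e≡p : toℕ e ≡ toℕ p
    e≡p = ℕP.≤-antisym (ℕP.≤-pred (subst (suc (toℕ e) ℕ.≤_) q≡1+p e<q)) p≤e

  consecutive-punchIn-punchOut : ∀ {n} {j p q : Fin (suc n)} (j≢p : j ≢ p) (j≢q : j ≢ q) → Consecutive p q →
    Consecutive (punchIn j (punchOut j≢p)) (punchIn j (punchOut j≢q))
  consecutive-punchIn-punchOut j≢p j≢q q≡1+p = subst₂ Consecutive
    (sym (FinP.punchIn-punchOut j≢p)) (sym (FinP.punchIn-punchOut j≢q)) q≡1+p

  punchOut-consecutive : ∀ {n} {j p q : Fin (suc n)} (j≢p : j ≢ p) (j≢q : j ≢ q) →
    Consecutive p q → Consecutive (punchOut j≢p) (punchOut j≢q)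
  punchOut-consecutive {j = j} j≢p j≢q q≡1+p
    with punchIn-cases j (punchOut j≢p) | punchIn-cases j (punchOut j≢q) | consecutive-punchIn-punchOut j≢p j≢q q≡1+p
  ... | inj₁ (_ , eq₁) | inj₁ (_ , eq₂) | shifted = trans (sym eq₂) (trans shifted (cong suc eq₁))
  ... | inj₂ (_ , eq₁) | inj₂ (_ , eq₂) | shifted = ℕP.suc-injective (trans (sym eq₂) (trans shifted (cong suc eq₁)))
  ... | inj₁ (p′<j , eq₁) | inj₂ (j≤q′ , eq₂) | shifted =
    ⊥-elim (ℕP.<-irrefl refl (ℕP.<-≤-trans p′<j (subst (toℕ j ℕ.≤_) q′≡p′ j≤q′)))
    where
    q′≡p′ : toℕ (punchOut j≢q) ≡ toℕ (punchOut j≢p)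
    q′≡p′ = ℕP.suc-injective (trans (sym eq₂) (trans shifted (cong suc eq₁)))
  ... | inj₂ (j≤p′ , eq₁) | inj₁ (q′<j , eq₂) | shifted = ⊥-elim (ℕP.<-asym q′<j (ℕP.≤-<-trans j≤p′ p′<q′))
    where
    p′<q′ : toℕ (punchOut j≢p) ℕ.< toℕ (punchOut j≢q)
    p′<q′ = subst (toℕ (punchOut j≢p) ℕ.<_) (sym (trans (sym eq₂) (trans shifted (cong suc eq₁))))
                  (ℕP.m≤n⇒m≤1+n (ℕP.n<1+n _))

  sumFin-pair : ∀ {n} (t : Fin n → ℤ) {p q : Fin n} → Consecutive p q →
    (∀ j → j ≢ p → j ≢ q → t j ≡ + 0) → sumFin t ≡ t p + t q
  sumFin-pair {suc (suc n)} t {zero} {suc zero} refl t≗0 =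
    cong (λ s → t zero + s) (trans (cong (λ s → t (suc zero) + s) rest≡0) (ℤP.+-identityʳ (t (suc zero))))
    where
    rest≡0 : sumFin (λ j → t (suc (suc j))) ≡ + 0
    rest≡0 = sumFin-zero _ (λ j → t≗0 (suc (suc j)) (λ ()) (λ ()))
  sumFin-pair {suc n} t {suc p} {suc q} q≡1+p t≗0 =
    trans (cong (_+ sumFin (λ j → t (suc j))) (t≗0 zero (λ ()) (λ ())))
    (trans (ℤP.+-identityˡ _)
           (sumFin-pair (λ j → t (suc j)) (ℕP.suc-injective q≡1+p)
                        (λ j j≢p j≢q → t≗0 (suc j) (j≢p ∘ FinP.suc-injective) (j≢q ∘ FinP.suc-injective))))
  sumFin-pair {suc (suc n)} t {zero} {suc (suc q)} () t≗0
  sumFin-pair {suc n} t {zero} {zero} () t≗0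
  sumFin-pair {suc n} t {suc p} {zero} () t≗0

  det-consecutive-columns : ∀ {n} (M : Matrix n) {p q : Fin n} → Consecutive p q →
    (∀ a → M a p ≡ M a q) → det M ≡ + 0
  det-consecutive-columns {suc n} M {p} {q} q≡1+p col =
    trans (sumFin-pair (laplaceTerm M) q≡1+p other-term≡0) cancel
    where
    other-term≡0 : ∀ j → j ≢ p → j ≢ q → laplaceTerm M j ≡ + 0
    other-term≡0 j j≢p j≢q = begin
      sign (toℕ j) * (M zero j * det (minor M j)) ≡⟨ cong (λ d → sign (toℕ j) * (M zero j * d)) minor≡0 ⟩
      sign (toℕ j) * (M zero j * + 0)             ≡⟨ cong (sign (toℕ j) *_) (ℤP.*-zeroʳ (M zero j)) ⟩
      sign (toℕ j) * + 0                          ≡⟨ ℤP.*-zeroʳ (sign (toℕ j)) ⟩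
      + 0                                         ∎
      where
      open ≡-Reasoning
      minor≡0 : det (minor M j) ≡ + 0
      minor≡0 = det-consecutive-columns (minor M j) (punchOut-consecutive j≢p j≢q q≡1+p) λ a →
        subst₂ (λ u v → M (suc a) u ≡ M (suc a) v)
               (sym (FinP.punchIn-punchOut j≢p)) (sym (FinP.punchIn-punchOut j≢q)) (col (suc a))
    minor-p≡minor-q : ∀ a e → minor M p a e ≡ minor M q a e
    minor-p≡minor-q a e with punchIn-consecutive q≡1+p e
    ... | inj₁ same = cong (M (suc a)) same
    ... | inj₂ (p↦q , q↦p) rewrite p↦q | q↦p = sym (col (suc a))
    cancel : laplaceTerm M p + laplaceTerm M q ≡ + 0
    cancel rewrite q≡1+p | col zero | det-cong minor-p≡minor-q =
      opposite-signs (sign (toℕ p)) (M zero q) (det (minor M q))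
      where
      opposite-signs : ∀ s u d → s * (u * d) + (- s) * (u * d) ≡ + 0
      opposite-signs = solve-∀

  laplaceTerm-zero-entry : ∀ {n} (M : Matrix (suc n)) j → M zero j ≡ + 0 → laplaceTerm M j ≡ + 0
  laplaceTerm-zero-entry M j entry≡0 =
    trans (cong (λ u → sign (toℕ j) * (u * det (minor M j))) entry≡0) (ℤP.*-zeroʳ (sign (toℕ j)))

  det-first-row-zero : ∀ {n} (M : Matrix (suc n)) → (∀ j → M zero j ≡ + 0) → det M ≡ + 0
  det-first-row-zero M row≡0 = sumFin-zero _ (λ j → laplaceTerm-zero-entry M j (row≡0 j))

  det-first-row-unit : ∀ {n} (M : Matrix (suc n)) → M zero zero ≡ + 1 → (∀ j → M zero (suc j) ≡ + 0) →
    det M ≡ det (λ a b → M (suc a) (suc b))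
  det-first-row-unit M corner≡1 rest≡0 = begin
    laplaceTerm M zero + sumFin (λ j → laplaceTerm M (suc j)) ≡⟨ cong₂ _+_ first-term later-terms ⟩
    det (minor M zero) + + 0                                  ≡⟨ ℤP.+-identityʳ _ ⟩
    det (minor M zero)                                        ∎
    where
    open ≡-Reasoning
    first-term : laplaceTerm M zero ≡ det (minor M zero)
    first-term rewrite corner≡1 = trans (ℤP.*-identityˡ _) (ℤP.*-identityˡ _)
    later-terms : sumFin (λ j → laplaceTerm M (suc j)) ≡ + 0
    later-terms = sumFin-zero _ (λ j → laplaceTerm-zero-entry M (suc j) (rest≡0 j))

open Determinant

module TotalNonNegativity where

  open import Data.Integer using (_+_; _*_)

  ℕMatrix : Set
  ℕMatrix = ℕ → ℕ → ℤ

  Increasing : ∀ {r} → (Fin r → ℕ) → Set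
  Increasing {r} ρ = ∀ (a b : Fin r) → a Fin.< b → ρ a ℕ.< ρ b

  TotallyNonNegativeBelow : ℕ → ℕMatrix → Set
  TotallyNonNegativeBelow N A = ∀ r (ρ σ : Fin r → ℕ) → Increasing ρ → Increasing σ → (∀ a → ρ a ℕ.< N) →
    + 0 ℤ.≤ det (λ a b → A (ρ a) (σ b))

  *-nonNeg : ∀ {x y} → + 0 ℤ.≤ x → + 0 ℤ.≤ y → + 0 ℤ.≤ x * y
  *-nonNeg {+ m} {+ n} (ℤ.+≤+ _) (ℤ.+≤+ _) = subst (+ 0 ℤ.≤_) (ℤP.pos-* m n) (ℤ.+≤+ ℕ.z≤n)

  combination-nonNeg : ∀ {x y u v} → + 0 ℤ.≤ x → + 0 ℤ.≤ y → + 0 ℤ.≤ u → + 0 ℤ.≤ v → + 0 ℤ.≤ x * u + y * v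
  combination-nonNeg 0≤x 0≤y 0≤u 0≤v = ℤP.+-mono-≤ (*-nonNeg 0≤x 0≤u) (*-nonNeg 0≤y 0≤v)

  unitRow : ℕ → ℤ
  unitRow zero    = + 1
  unitRow (suc k) = + 0

  prev : (ℕ → ℤ) → ℕ → ℤ
  prev f zero    = + 0
  prev f (suc k) = f k

  -- extend A d = (1 ⊕ A) U, where U is upper bidiagonal with diagonal d and ones above it.
  extend : ℕMatrix → (ℕ → ℤ) → ℕMatrix
  extend A d zero    = unitRow
  extend A d (suc m) k = prev (A m) k + d k * A m k

  zero-or-last : ∀ {r} p → p ℕ.< r → p ≡ 0 ⊎ ∃ λ (a : Fin r) → suc (toℕ a) ≡ p
  zero-or-last zero    _     = inj₁ refl
  zero-or-last {r} (suc p) 1+p<r = inj₂ (fromℕ< p<r , cong suc (FinP.toℕ-fromℕ< p<r))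
    where
    p<r : p ℕ.< r
    p<r = ℕP.<-trans (ℕP.n<1+n p) 1+p<r

  module ExtendMinor {N : ℕ} (A : ℕMatrix) (d : ℕ → ℤ) (d≥0 : ∀ k → + 0 ℤ.≤ d k)
                     (A-tnn : TotallyNonNegativeBelow N A)
                     {r : ℕ} (ρ σ : Fin r → ℕ) (ρ↑ : Increasing ρ) (σ↑ : Increasing σ) (ρ<N : ∀ a → ρ a ℕ.< N) where

    -- The first p columns of the minor of extend A d have been expanded into the columns τ of A.
    mixed : ℕ → (Fin r → ℕ) → Matrix r
    mixed p τ a b with toℕ b ℕ.<? p
    ... | yes _ = A (ρ a) (τ b)
    ... | no _  = extend A d (suc (ρ a)) (σ b)

    mixed-expanded : ∀ {p} τ a b → toℕ b ℕ.< p → mixed p τ a b ≡ A (ρ a) (τ b)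
    mixed-expanded {p} τ a b b<p with toℕ b ℕ.<? p
    ... | yes _  = refl
    ... | no b≮p = ⊥-elim (b≮p b<p)

    mixed-pending : ∀ {p} τ a b → ¬ toℕ b ℕ.< p → mixed p τ a b ≡ extend A d (suc (ρ a)) (σ b)
    mixed-pending {p} τ a b b≮p with toℕ b ℕ.<? p
    ... | yes b<p = ⊥-elim (b≮p b<p)
    ... | no _    = refl

    -- Each expanded column τ b is σ b or σ b - 1; keeping the choices increasing makes the fully
    -- expanded matrix a minor of A.
    record Admissible (p : ℕ) (τ : Fin r → ℕ) : Set where
      field
        increasing : ∀ a b → a Fin.< b → toℕ b ℕ.< p → τ a ℕ.< τ b
        below-σ    : ∀ b → toℕ b ℕ.< p → τ b ℕ.≤ σ b
    open Admissible

    det-mixed-complete : ∀ τ → Admissible r τ → + 0 ℤ.≤ det (mixed r τ)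
    det-mixed-complete τ adm =
      subst (+ 0 ℤ.≤_) (det-cong (λ a b → sym (mixed-expanded τ a b (FinP.toℕ<n b))))
            (A-tnn r ρ τ ρ↑ (λ a b a<b → increasing adm a b a<b (FinP.toℕ<n b)) ρ<N)

    module Step {p : ℕ} (p<r : p ℕ.< r) where

      b₀ : Fin r
      b₀ = fromℕ< p<r

      toℕ-b₀ : toℕ b₀ ≡ p
      toℕ-b₀ = FinP.toℕ-fromℕ< p<r

      choose : ℕ → (Fin r → ℕ) → Fin r → ℕ
      choose v τ = VF.updateAt τ b₀ (const v)

      choose-other : ∀ {j} v τ → toℕ j ≢ p → choose v τ j ≡ τ j
      choose-other {j} v τ j≢p = updateAt-minimal j b₀ τ (λ j≡b₀ → j≢p (trans (cong toℕ j≡b₀) toℕ-b₀))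

      choose-here : ∀ {j} v τ → toℕ j ≡ p → choose v τ j ≡ v
      choose-here {j} v τ j≡p rewrite FinP.toℕ-injective (trans j≡p (sym toℕ-b₀)) = updateAt-updates b₀ τ

      mixed-choose-other : ∀ v τ a j → toℕ j ≢ p → mixed (suc p) (choose v τ) a j ≡ mixed p τ a j
      mixed-choose-other v τ a j j≢p with toℕ j ℕ.<? p
      ... | yes j<p = trans (mixed-expanded _ a j (ℕP.m≤n⇒m≤1+n j<p))
                            (cong (A (ρ a)) (choose-other v τ j≢p))
      ... | no j≮p  = mixed-pending _ a j (λ j<1+p → j≢p (ℕP.≤-antisym (ℕP.≤-pred j<1+p) (ℕP.≮⇒≥ j≮p)))

      mixed-choose-here : ∀ v τ a → mixed (suc p) (choose v τ) a b₀ ≡ A (ρ a) v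
      mixed-choose-here v τ a = trans (mixed-expanded _ a b₀ (subst (ℕ._< suc p) (sym toℕ-b₀) (ℕP.n<1+n p)))
                                      (cong (A (ρ a)) (choose-here v τ toℕ-b₀))

      det-mixed-split : ∀ τ (x : ℤ) v₁ v₂ →
        (∀ a → extend A d (suc (ρ a)) (σ b₀) ≡ x * A (ρ a) v₁ + d (σ b₀) * A (ρ a) v₂) →
        det (mixed p τ) ≡ x * det (mixed (suc p) (choose v₁ τ)) + d (σ b₀) * det (mixed (suc p) (choose v₂ τ))
      det-mixed-split τ x v₁ v₂ column = det-linear-column b₀ x (d (σ b₀)) _ _ _
        (λ a j j≢b₀ → mixed-choose-other v₁ τ a j (≢b₀ j≢b₀))
        (λ a j j≢b₀ → mixed-choose-other v₂ τ a j (≢b₀ j≢b₀))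
        (λ a → begin
          mixed p τ a b₀                             ≡⟨ mixed-pending τ a b₀ (ℕP.<-irrefl toℕ-b₀) ⟩
          extend A d (suc (ρ a)) (σ b₀)              ≡⟨ column a ⟩
          x * A (ρ a) v₁ + d (σ b₀) * A (ρ a) v₂     ≡⟨ sym (cong₂ (λ u w → x * u + d (σ b₀) * w)
                                                          (mixed-choose-here v₁ τ a) (mixed-choose-here v₂ τ a)) ⟩
          x * mixed (suc p) (choose v₁ τ) a b₀ + d (σ b₀) * mixed (suc p) (choose v₂ τ) a b₀ ∎)
        where
        open ≡-Reasoning
        ≢b₀ : ∀ {j} → j ≢ b₀ → toℕ j ≢ p
        ≢b₀ j≢b₀ j≡p = j≢b₀ (FinP.toℕ-injective (trans j≡p (sym toℕ-b₀)))

      admissible-choose : ∀ {τ v} → Admissible p τ → (∀ a → toℕ a ℕ.< p → τ a ℕ.< v) → v ℕ.≤ σ b₀ →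
                          Admissible (suc p) (choose v τ)
      admissible-choose {τ} {v} adm τ<v v≤σ = record { increasing = incr ; below-σ = below }
        where
        incr : ∀ a b → a Fin.< b → toℕ b ℕ.< suc p → choose v τ a ℕ.< choose v τ b
        incr a b a<b b<1+p with toℕ b ℕ.≟ p
        ... | yes b≡p = subst₂ ℕ._<_ (sym (choose-other v τ (ℕP.<⇒≢ a<p))) (sym (choose-here v τ b≡p)) (τ<v a a<p)
          where
          a<p : toℕ a ℕ.< p
          a<p = subst (toℕ a ℕ.<_) b≡p a<b
        ... | no b≢p = subst₂ ℕ._<_ (sym (choose-other v τ (ℕP.<⇒≢ a<p))) (sym (choose-other v τ b≢p))
                              (increasing adm a b a<b b<p)
          where
          b<p : toℕ b ℕ.< p
          b<p = ℕP.≤∧≢⇒< (ℕP.≤-pred b<1+p) b≢p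
          a<p : toℕ a ℕ.< p
          a<p = ℕP.<-trans a<b b<p
        below : ∀ b → toℕ b ℕ.< suc p → choose v τ b ℕ.≤ σ b
        below b b<1+p with toℕ b ℕ.≟ p
        ... | yes b≡p = subst₂ ℕ._≤_ (sym (choose-here v τ b≡p))
                               (cong σ (FinP.toℕ-injective (trans toℕ-b₀ (sym b≡p)))) v≤σ
        ... | no b≢p  = subst (ℕ._≤ σ b) (sym (choose-other v τ b≢p))
                              (below-σ adm b (ℕP.≤∧≢⇒< (ℕP.≤-pred b<1+p) b≢p))

      expanded-below-σ : ∀ {τ} → Admissible p τ → ∀ a → toℕ a ℕ.< p → τ a ℕ.< σ b₀
      expanded-below-σ adm a a<p = ℕP.≤-<-trans (below-σ adm a a<p) (σ↑ a b₀ (subst (toℕ a ℕ.<_) (sym toℕ-b₀) a<p))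

      module _ (IH : ∀ τ → Admissible (suc p) τ → + 0 ℤ.≤ det (mixed (suc p) τ)) where

        upper-choice-nonNeg : ∀ {τ} → Admissible p τ → + 0 ℤ.≤ det (mixed (suc p) (choose (σ b₀) τ))
        upper-choice-nonNeg adm = IH _ (admissible-choose adm (expanded-below-σ adm) ℕP.≤-refl)

        -- The choice σ b₀ - 1 either repeats the previous expanded column, so that the determinant
        -- vanishes, or keeps the choices increasing.
        lower-choice-nonNeg : ∀ {τ} s → Admissible p τ → suc s ≡ σ b₀ →
                              + 0 ℤ.≤ det (mixed (suc p) (choose s τ))
        lower-choice-nonNeg {τ} s adm 1+s≡σ with zero-or-last p p<r
        ... | inj₁ refl = IH _ (admissible-choose adm (λ a ()) (subst (s ℕ.≤_) 1+s≡σ (ℕP.n≤1+n s)))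
        ... | inj₂ (a₀ , 1+a₀≡p) with τ a₀ ℕ.≟ s
        ...   | yes τa₀≡s = ℤP.≤-reflexive (sym (det-consecutive-columns _ (trans toℕ-b₀ (sym 1+a₀≡p)) same-column))
          where
          same-column : ∀ a → mixed (suc p) (choose s τ) a a₀ ≡ mixed (suc p) (choose s τ) a b₀
          same-column a = begin
            mixed (suc p) (choose s τ) a a₀ ≡⟨ mixed-expanded _ a a₀ (ℕP.m<n⇒m<1+n a₀<p) ⟩
            A (ρ a) (choose s τ a₀)         ≡⟨ cong (A (ρ a)) (trans (choose-other s τ (ℕP.<⇒≢ a₀<p)) τa₀≡s) ⟩
            A (ρ a) s                       ≡⟨ sym (mixed-choose-here s τ a) ⟩
            mixed (suc p) (choose s τ) a b₀ ∎
            where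
            open ≡-Reasoning
            a₀<p : toℕ a₀ ℕ.< p
            a₀<p = ℕP.≤-reflexive 1+a₀≡p
        ...   | no τa₀≢s = IH _ (admissible-choose adm τ<s (subst (s ℕ.≤_) 1+s≡σ (ℕP.n≤1+n s)))
          where
          a₀<p : toℕ a₀ ℕ.< p
          a₀<p = ℕP.≤-reflexive 1+a₀≡p
          τa₀<s : τ a₀ ℕ.< s
          τa₀<s = ℕP.≤∧≢⇒< (ℕP.≤-pred (subst (τ a₀ ℕ.<_) (sym 1+s≡σ) (expanded-below-σ adm a₀ a₀<p)))
                           τa₀≢s
          τ<s : ∀ a → toℕ a ℕ.< p → τ a ℕ.< s
          τ<s a a<p with toℕ a ℕ.≟ toℕ a₀
          ... | yes a≡a₀ rewrite FinP.toℕ-injective a≡a₀ = τa₀<s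
          ... | no a≢a₀  = ℕP.<-trans (increasing adm a a₀ a<a₀ a₀<p) τa₀<s
            where
            a<a₀ : a Fin.< a₀
            a<a₀ = ℕP.≤∧≢⇒< (ℕP.≤-pred (subst (toℕ a ℕ.<_) (sym 1+a₀≡p) a<p)) a≢a₀

        det-mixed-step : ∀ τ → Admissible p τ → + 0 ℤ.≤ det (mixed p τ)
        det-mixed-step τ adm with σ b₀ in σb₀≡
        ... | zero  = subst (+ 0 ℤ.≤_) (sym (det-mixed-split τ (+ 0) (σ b₀) (σ b₀) column))
                            (combination-nonNeg {x = + 0} ℤP.≤-refl (d≥0 (σ b₀))
                                                (upper-choice-nonNeg adm) (upper-choice-nonNeg adm))
          where
          column : ∀ a → extend A d (suc (ρ a)) (σ b₀) ≡ + 0 * A (ρ a) (σ b₀) + d (σ b₀) * A (ρ a) (σ b₀)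
          column a rewrite σb₀≡ = cong (_+ d 0 * A (ρ a) 0) (sym (ℤP.*-zeroˡ (A (ρ a) 0)))
        ... | suc s = subst (+ 0 ℤ.≤_) (sym (det-mixed-split τ (+ 1) s (σ b₀) column))
                            (combination-nonNeg {x = + 1} (ℤ.+≤+ ℕ.z≤n) (d≥0 (σ b₀))
                                                (lower-choice-nonNeg s adm (sym σb₀≡)) (upper-choice-nonNeg adm))
          where
          column : ∀ a → extend A d (suc (ρ a)) (σ b₀) ≡ + 1 * A (ρ a) s + d (σ b₀) * A (ρ a) (σ b₀)
          column a rewrite σb₀≡ = cong (_+ d (suc s) * A (ρ a) (suc s)) (sym (ℤP.*-identityˡ (A (ρ a) s)))

    det-mixed-nonNeg : ∀ q p τ → q ℕ.+ p ≡ r → Admissible p τ → + 0 ℤ.≤ det (mixed p τ)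
    det-mixed-nonNeg zero    p τ refl adm = det-mixed-complete τ adm
    det-mixed-nonNeg (suc q) p τ q+p≡r adm =
      Step.det-mixed-step p<r (λ τ′ → det-mixed-nonNeg q (suc p) τ′ (trans (ℕP.+-suc q p) q+p≡r)) τ adm
      where
      p<r : p ℕ.< r
      p<r = subst (p ℕ.<_) q+p≡r (ℕP.m<n+m p (ℕ.s≤s ℕ.z≤n))

    det-extend-nonNeg : + 0 ℤ.≤ det (λ a b → extend A d (suc (ρ a)) (σ b))
    det-extend-nonNeg =
      subst (+ 0 ℤ.≤_) (det-cong (λ a b → mixed-pending {0} σ a b (λ ())))
            (det-mixed-nonNeg r 0 σ (ℕP.+-identityʳ r) (record { increasing = λ _ _ _ (); below-σ = λ _ () }))

  first-least : ∀ {r} (τ : Fin (suc r) → ℕ) → Increasing τ → ∀ a → τ zero ℕ.≤ τ a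
  first-least τ τ↑ zero    = ℕP.≤-refl
  first-least τ τ↑ (suc a) = ℕP.<⇒≤ (τ↑ zero (suc a) (ℕ.s≤s ℕ.z≤n))

  unitRow-positive : ∀ {k} → 0 ℕ.< k → unitRow k ≡ + 0
  unitRow-positive {suc k} _ = refl

  module _ {N : ℕ} (A : ℕMatrix) (d : ℕ → ℤ) (d≥0 : ∀ k → + 0 ℤ.≤ d k)
           (A-tnn : TotallyNonNegativeBelow N A) where

    det-extend-positive-rows : ∀ r (ρ σ : Fin r → ℕ) → Increasing ρ → Increasing σ →
      (∀ a → 0 ℕ.< ρ a) → (∀ a → ρ a ℕ.< suc N) → + 0 ℤ.≤ det (λ a b → extend A d (ρ a) (σ b))
    det-extend-positive-rows r ρ σ ρ↑ σ↑ ρ>0 ρ≤N =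
      subst (+ 0 ℤ.≤_) (det-cong (λ a b → cong (λ m → extend A d m (σ b)) (ℕP.suc-pred (ρ a) ⦃ ℕ.>-nonZero (ρ>0 a) ⦄)))
            (ExtendMinor.det-extend-nonNeg A d d≥0 A-tnn (ℕ.pred ∘ ρ) σ pred-ρ↑ σ↑ (λ a → pred-mono-< (ρ>0 a) (ρ≤N a)))
      where
      pred-mono-< : ∀ {x y} → 0 ℕ.< x → x ℕ.< y → ℕ.pred x ℕ.< ℕ.pred y
      pred-mono-< {suc x} {suc y} _ (ℕ.s≤s x<y) = x<y
      pred-ρ↑ : Increasing (ℕ.pred ∘ ρ)
      pred-ρ↑ a b a<b = pred-mono-< (ρ>0 a) (ρ↑ a b a<b)

    extend-totallyNonNegative : TotallyNonNegativeBelow (suc N) (extend A d)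
    extend-totallyNonNegative zero    ρ σ ρ↑ σ↑ ρ≤N = ℤ.+≤+ ℕ.z≤n
    extend-totallyNonNegative (suc r) ρ σ ρ↑ σ↑ ρ≤N = by-corner (ρ zero) refl (σ zero) refl
      where
      by-corner : ∀ m → ρ zero ≡ m → ∀ k → σ zero ≡ k → + 0 ℤ.≤ det (λ a b → extend A d (ρ a) (σ b))
      by-corner (suc _) ρ₀≡ _ _ =
        det-extend-positive-rows (suc r) ρ σ ρ↑ σ↑
          (λ a → ℕP.<-≤-trans (subst (0 ℕ.<_) (sym ρ₀≡) (ℕ.s≤s ℕ.z≤n)) (first-least ρ ρ↑ a)) ρ≤N
      by-corner zero ρ₀≡ (suc _) σ₀≡ =
        ℤP.≤-reflexive (sym (det-first-row-zero (λ a b → extend A d (ρ a) (σ b)) first-row≡0))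
        where
        first-row≡0 : ∀ j → extend A d (ρ zero) (σ j) ≡ + 0
        first-row≡0 j rewrite ρ₀≡ =
          unitRow-positive (ℕP.<-≤-trans (subst (0 ℕ.<_) (sym σ₀≡) (ℕ.s≤s ℕ.z≤n)) (first-least σ σ↑ j))
      by-corner zero ρ₀≡ zero σ₀≡ =
        subst (+ 0 ℤ.≤_) (sym (det-first-row-unit (λ a b → extend A d (ρ a) (σ b)) corner≡1 rest≡0))
        (det-extend-positive-rows r (ρ ∘ suc) (σ ∘ suc) (λ a b a<b → ρ↑ (suc a) (suc b) (ℕ.s≤s a<b))
                                  (λ a b a<b → σ↑ (suc a) (suc b) (ℕ.s≤s a<b))
                                  (λ a → subst (ℕ._< ρ (suc a)) ρ₀≡ (ρ↑ zero (suc a) (ℕ.s≤s ℕ.z≤n))) (ρ≤N ∘ suc))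
        where
        corner≡1 : extend A d (ρ zero) (σ zero) ≡ + 1
        corner≡1 rewrite ρ₀≡ | σ₀≡ = refl
        rest≡0 : ∀ j → extend A d (ρ zero) (σ (suc j)) ≡ + 0
        rest≡0 j rewrite ρ₀≡ = unitRow-positive (ℕP.≤-<-trans ℕ.z≤n (σ↑ zero (suc j) (ℕ.s≤s ℕ.z≤n)))

  genStirling : (ℕ → ℤ) → ℕMatrix
  genStirling c zero    = unitRow
  genStirling c (suc m) k = prev (genStirling c m) k + (+ k - c m) * genStirling c m k

  -- The steps of the recurrence commute, so the first one can be performed last.
  genStirling-first-last : ∀ c m k →
    genStirling c (suc m) k ≡ prev (genStirling (c ∘ suc) m) k + (+ k - c 0) * genStirling (c ∘ suc) m k
  genStirling-first-last c zero zero = refl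
  genStirling-first-last c zero (suc zero) = refl
  genStirling-first-last c zero (suc (suc k)) = refl
  genStirling-first-last c (suc m) zero
    rewrite genStirling-first-last c m zero =
      swap-at-zero (c (suc m)) (c 0) (genStirling (c ∘ suc) m 0)
    where
    swap-at-zero : ∀ c₁ c₀ x → + 0 + (+ 0 - c₁) * (+ 0 + (+ 0 - c₀) * x) ≡ + 0 + (+ 0 - c₀) * (+ 0 + (+ 0 - c₁) * x)
    swap-at-zero = solve-∀
  genStirling-first-last c (suc m) (suc k)
    rewrite genStirling-first-last c m k | genStirling-first-last c m (suc k) =
      swap (+ k) (c 0) (c (suc m)) (prev (genStirling (c ∘ suc) m) k) (genStirling (c ∘ suc) m k)
           (genStirling (c ∘ suc) m (suc k))
    where
    swap : ∀ k c₀ c₁ p x y → (p + (k - c₀) * x) + ((+ 1 + k) - c₁) * (x + ((+ 1 + k) - c₀) * y)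
                           ≡ (p + (k - c₁) * x) + ((+ 1 + k) - c₀) * (x + ((+ 1 + k) - c₁) * y)
    swap = solve-∀

  genStirling-extend : ∀ c m k → genStirling c m k ≡ extend (genStirling (c ∘ suc)) (λ k → + k - c 0) m k
  genStirling-extend c zero    k = refl
  genStirling-extend c (suc m) k = genStirling-first-last c m k

  -- If c 0 = 0 the tail c ∘ suc may violate BoundedGrowth; instead the first step is absorbed by
  -- shifting the column index, which lowers the rest of c by one.
  tailMinusOne : (ℕ → ℤ) → ℕ → ℤ
  tailMinusOne c i = c (suc i) - + 1

  genStirling-isolated-first : ∀ c → c 0 ≡ + 0 → ∀ m k →
    genStirling c (suc m) k ≡ prev (genStirling (tailMinusOne c) m) k
  genStirling-isolated-first c c₀≡0 zero zero rewrite c₀≡0 = refl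
  genStirling-isolated-first c c₀≡0 zero (suc k) =
    trans (cong (λ x → unitRow k + x) (ℤP.*-zeroʳ (+ suc k - c 0))) (ℤP.+-identityʳ (unitRow k))
  genStirling-isolated-first c c₀≡0 (suc m) zero rewrite genStirling-isolated-first c c₀≡0 m zero =
    trans (ℤP.+-identityˡ _) (ℤP.*-zeroʳ (+ 0 - c (suc m)))
  genStirling-isolated-first c c₀≡0 (suc m) (suc k)
    rewrite genStirling-isolated-first c c₀≡0 m (suc k) | genStirling-isolated-first c c₀≡0 m k =
      cong (λ x → prev (genStirling (tailMinusOne c) m) k + x * genStirling (tailMinusOne c) m k)
           (shift-one (+ k) (c (suc m)))
    where
    shift-one : ∀ k c → (+ 1 + k) - c ≡ k - (c - + 1)
    shift-one = solve-∀

  genStirling-extend-isolated : ∀ c → c 0 ≡ + 0 → ∀ m k →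
    genStirling c m k ≡ extend (genStirling (tailMinusOne c)) (const (+ 0)) m k
  genStirling-extend-isolated c c₀≡0 zero    k = refl
  genStirling-extend-isolated c c₀≡0 (suc m) k = begin
    genStirling c (suc m) k                                 ≡⟨ genStirling-isolated-first c c₀≡0 m k ⟩
    prev (S m) k                                            ≡⟨ sym (ℤP.+-identityʳ _) ⟩
    prev (S m) k + + 0                                      ≡⟨ cong (λ x → prev (S m) k + x) (sym (ℤP.*-zeroˡ (S m k))) ⟩
    prev (S m) k + + 0 * S m k                              ∎
    where
    open ≡-Reasoning
    S : ℕMatrix
    S = genStirling (tailMinusOne c)

  BoundedGrowth : (ℕ → ℤ) → Set
  BoundedGrowth c = ∀ i → c i ℤ.≤ + 0 ⊎ ∃ λ j → j ℕ.< i × c i ℤ.≤ c j + + 1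

  totallyNonNegativeBelow-cong : ∀ {N} {A B : ℕMatrix} → (∀ m k → A m k ≡ B m k) →
    TotallyNonNegativeBelow N B → TotallyNonNegativeBelow N A
  totallyNonNegativeBelow-cong A≗B B-tnn r ρ σ ρ↑ σ↑ ρ<N =
    subst (+ 0 ℤ.≤_) (det-cong (λ a b → sym (A≗B (ρ a) (σ b)))) (B-tnn r ρ σ ρ↑ σ↑ ρ<N)

  boundedGrowth-tail : ∀ {c} → BoundedGrowth c → c 0 ℤ.< + 0 → BoundedGrowth (c ∘ suc)
  boundedGrowth-tail {c} growth c₀<0 i with growth (suc i)
  ... | inj₁ cᵢ≤0                      = inj₁ cᵢ≤0
  ... | inj₂ (zero , _ , cᵢ≤c₀+1)       = inj₁ (ℤP.≤-trans cᵢ≤c₀+1 (negative+1≤0 c₀<0))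
    where
    negative+1≤0 : ∀ {x} → x ℤ.< + 0 → x + + 1 ℤ.≤ + 0
    negative+1≤0 { -[1+ zero  ]} _ = ℤ.+≤+ ℕ.z≤n
    negative+1≤0 { -[1+ suc n ]} _ = ℤ.-≤+
    negative+1≤0 {+ n} (ℤ.+<+ ())
  ... | inj₂ (suc j , ℕ.s≤s j<i , cᵢ≤cⱼ+1) = inj₂ (j , j<i , cᵢ≤cⱼ+1)

  boundedGrowth-tailMinusOne : ∀ {c} → BoundedGrowth c → c 0 ≡ + 0 → BoundedGrowth (tailMinusOne c)
  boundedGrowth-tailMinusOne {c} growth c₀≡0 i with growth (suc i)
  ... | inj₁ cᵢ≤0 = inj₁ (ℤP.≤-trans (ℤP.i-j≤i (c (suc i)) (+ 1)) cᵢ≤0)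
  ... | inj₂ (zero , _ , cᵢ≤c₀+1) rewrite c₀≡0 = inj₁ (ℤP.+-monoˡ-≤ (- + 1) cᵢ≤c₀+1)
  ... | inj₂ (suc j , ℕ.s≤s j<i , cᵢ≤cⱼ+1) =
    inj₂ (j , j<i , subst (c (suc i) - + 1 ℤ.≤_) (add-sub-swap (c (suc j))) (ℤP.+-monoˡ-≤ (- + 1) cᵢ≤cⱼ+1))
    where
    add-sub-swap : ∀ x → x + + 1 - + 1 ≡ x - + 1 + + 1
    add-sub-swap = solve-∀

  genStirling-totallyNonNegative : ∀ N c → BoundedGrowth c → TotallyNonNegativeBelow N (genStirling c)
  genStirling-totallyNonNegative zero c growth zero    ρ σ ρ↑ σ↑ ρ<0 = ℤ.+≤+ ℕ.z≤n
  genStirling-totallyNonNegative zero c growth (suc r) ρ σ ρ↑ σ↑ ρ<0 with ρ<0 Fin.zero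
  ... | ()
  genStirling-totallyNonNegative (suc N) c growth with c 0 in c₀≡
  ... | -[1+ n ] = totallyNonNegativeBelow-cong (genStirling-extend c)
    (extend-totallyNonNegative (genStirling (c ∘ suc)) (λ k → + k - c 0) d≥0
       (genStirling-totallyNonNegative N (c ∘ suc) (boundedGrowth-tail growth c₀<0)))
    where
    c₀<0 : c 0 ℤ.< + 0
    c₀<0 rewrite c₀≡ = ℤ.-<+
    d≥0 : ∀ k → + 0 ℤ.≤ + k - c 0
    d≥0 k rewrite c₀≡ = ℤ.+≤+ ℕ.z≤n
  ... | + zero = totallyNonNegativeBelow-cong (genStirling-extend-isolated c c₀≡)
    (extend-totallyNonNegative (genStirling (tailMinusOne c)) (const (+ 0)) (λ _ → ℤP.≤-refl)
       (genStirling-totallyNonNegative N (tailMinusOne c) (boundedGrowth-tailMinusOne growth c₀≡)))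
  ... | + suc n with growth 0
  ...   | inj₂ (_ , () , _)
  ...   | inj₁ c₀≤0 with subst (ℤ._≤ + 0) c₀≡ c₀≤0
  ...     | ℤ.+≤+ ()

open TotalNonNegativity

module Counting where

  open import Data.Nat using (_+_; _*_)
  open SemiringSum ℕP.+-*-semiring
    using (sum; sum-cong-≗; ∑-distrib-+; *-distribˡ-sum; sum-init-last; sum-remove; sum-replicate-zero)

  indicator : ∀ {P : Set} → Dec P → ℕ
  indicator (yes _) = 1
  indicator (no _)  = 0

  indicator-cong : ∀ {P Q : Set} (p : Dec P) (q : Dec Q) → (P → Q) → (Q → P) → indicator p ≡ indicator q
  indicator-cong (yes _)  (yes _)  _ _ = refl
  indicator-cong (yes p)  (no ¬q)  f _ = ⊥-elim (¬q (f p))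
  indicator-cong (no ¬p)  (yes q)  _ g = ⊥-elim (¬p (g q))
  indicator-cong (no _)   (no _)   _ _ = refl

  indicator-yes : ∀ {P : Set} (p : Dec P) → P → indicator p ≡ 1
  indicator-yes (yes _) _  = refl
  indicator-yes (no ¬p) p = ⊥-elim (¬p p)

  indicator-no : ∀ {P : Set} (p : Dec P) → ¬ P → indicator p ≡ 0
  indicator-no (yes p) ¬p = ⊥-elim (¬p p)
  indicator-no (no _)  _  = refl

  indicator-mono : ∀ {P Q : Set} (p : Dec P) (q : Dec Q) → (P → Q) → indicator p ℕ.≤ indicator q
  indicator-mono (yes p) (yes _) _ = ℕP.≤-refl
  indicator-mono (yes p) (no ¬q) f = ⊥-elim (¬q (f p))
  indicator-mono (no _)  _       _ = ℕ.z≤n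

  sum-zero : ∀ {n} (f : Fin n → ℕ) → (∀ i → f i ≡ 0) → sum f ≡ 0
  sum-zero {n} f f≗0 = trans (sum-cong-≗ f≗0) (sum-replicate-zero n)

  sum-single : ∀ {n} (f : Fin n → ℕ) (x : Fin n) → (∀ i → i ≢ x → f i ≡ 0) → sum f ≡ f x
  sum-single {suc n} f x others≡0 = begin
    sum f                          ≡⟨ sum-remove {i = x} f ⟩
    f x + sum (f ∘ Fin.punchIn x)  ≡⟨ cong (λ s → f x + s) (sum-zero _ (λ i → others≡0 _ (FinP.punchInᵢ≢i x i))) ⟩
    f x + 0                        ≡⟨ ℕP.+-identityʳ (f x) ⟩
    f x                            ∎
    where open ≡-Reasoning

  sum-ones : ∀ n → sum {n} (λ _ → 1) ≡ n
  sum-ones zero    = refl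
  sum-ones (suc n) = cong suc (sum-ones n)

  sum-*ˡ : ∀ {n} x (f : Fin n → ℕ) → sum (λ i → x * f i) ≡ x * sum f
  sum-*ˡ x f = sym (*-distribˡ-sum x f)

  Extensional : ∀ {m k} → ((Fin m → Fin k) → ℕ) → Set
  Extensional {m} {k} F = ∀ f g → (∀ i → f i ≡ g i) → F f ≡ F g

  sumFun : ∀ m k → ((Fin m → Fin k) → ℕ) → ℕ
  sumFun zero    k F = F (λ ())
  sumFun (suc m) k F = sum (λ c → sumFun m k (λ g → F (c VF.∷ g)))

  sumFun-cong : ∀ m k {F G : (Fin m → Fin k) → ℕ} → (∀ f → F f ≡ G f) → sumFun m k F ≡ sumFun m k G
  sumFun-cong zero    k F≗G = F≗G _
  sumFun-cong (suc m) k F≗G = sum-cong-≗ {k} (λ c → sumFun-cong m k (λ g → F≗G _))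

  sumFun-distrib-+ : ∀ m k (F G : (Fin m → Fin k) → ℕ) → sumFun m k (λ f → F f + G f) ≡ sumFun m k F + sumFun m k G
  sumFun-distrib-+ zero    k F G = refl
  sumFun-distrib-+ (suc m) k F G = trans (sum-cong-≗ {k} (λ c → sumFun-distrib-+ m k _ _)) (∑-distrib-+ {k} _ _)

  sumFun-*ˡ : ∀ m k x (F : (Fin m → Fin k) → ℕ) → sumFun m k (λ f → x * F f) ≡ x * sumFun m k F
  sumFun-*ˡ zero    k x F = refl
  sumFun-*ˡ (suc m) k x F = trans (sum-cong-≗ {k} (λ c → sumFun-*ˡ m k x _)) (sum-*ˡ {k} x _)

  sumFun-zero : ∀ m k (F : (Fin m → Fin k) → ℕ) → (∀ f → F f ≡ 0) → sumFun m k F ≡ 0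
  sumFun-zero zero    k F F≗0 = F≗0 _
  sumFun-zero (suc m) k F F≗0 = sum-zero {k} _ (λ c → sumFun-zero m k _ (λ g → F≗0 _))

  snoc : ∀ {m k} → (Fin m → Fin k) → Fin k → Fin (suc m) → Fin k
  snoc {zero}  g x _       = x
  snoc {suc m} g x zero    = g zero
  snoc {suc m} g x (suc i) = snoc (g ∘ suc) x i

  snoc-inject₁ : ∀ {m k} (g : Fin m → Fin k) x i → snoc g x (inject₁ i) ≡ g i
  snoc-inject₁ {suc m} g x zero    = refl
  snoc-inject₁ {suc m} g x (suc i) = snoc-inject₁ (g ∘ suc) x i

  snoc-last : ∀ {m k} (g : Fin m → Fin k) x → snoc g x (fromℕ m) ≡ x
  snoc-last {zero}  g x = refl
  snoc-last {suc m} g x = snoc-last (g ∘ suc) x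

  ∷-cong : ∀ {m k} (c : Fin k) {f g : Fin m → Fin k} → (∀ i → f i ≡ g i) → ∀ i → (c VF.∷ f) i ≡ (c VF.∷ g) i
  ∷-cong c f≗g zero    = refl
  ∷-cong c f≗g (suc i) = f≗g i

  sumFun-snoc : ∀ m k (F : (Fin (suc m) → Fin k) → ℕ) → Extensional F →
    sumFun (suc m) k F ≡ sumFun m k (λ g → sum (λ x → F (snoc g x)))
  sumFun-snoc zero    k F ext = sum-cong-≗ {k} (λ c → ext _ _ (λ { zero → refl }))
  sumFun-snoc (suc m) k F ext =
    trans (sum-cong-≗ {k} (λ c → sumFun-snoc m k (λ g → F (c VF.∷ g)) (λ f g f≗g → ext _ _ (∷-cong c f≗g))))
          (sum-cong-≗ {k} (λ c → sumFun-cong m k (λ g → sum-cong-≗ {k} (λ x →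
             ext _ _ (λ { zero → refl ; (suc i) → refl })))))

  sumFun-narrow : ∀ m k (F : (Fin m → Fin (suc k)) → ℕ) → Extensional F →
    (∀ g i → g i ≡ fromℕ k → F g ≡ 0) → sumFun m (suc k) F ≡ sumFun m k (λ g → F (inject₁ ∘ g))
  sumFun-narrow zero    k F ext _ = ext _ _ (λ ())
  sumFun-narrow (suc m) k F ext top⇒0 = begin
    sum (λ c → sumFun m (suc k) (λ g → F (c VF.∷ g)))
      ≡⟨ sum-init-last (λ c → sumFun m (suc k) (λ g → F (c VF.∷ g))) ⟩
    sum (λ c → sumFun m (suc k) (λ g → F (inject₁ c VF.∷ g))) + sumFun m (suc k) (λ g → F (fromℕ k VF.∷ g))
      ≡⟨ cong₂ _+_ (sum-cong-≗ {k} (λ c → sumFun-narrow m k _ (λ f g f≗g → ext _ _ (∷-cong _ f≗g))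
                                                      (λ g i gᵢ≡top → top⇒0 _ (suc i) gᵢ≡top)))
                   (sumFun-zero m (suc k) _ (λ g → top⇒0 _ zero refl)) ⟩
    sum (λ c → sumFun m k (λ g → F (inject₁ c VF.∷ inject₁ ∘ g))) + 0
      ≡⟨ ℕP.+-identityʳ _ ⟩
    sum (λ c → sumFun m k (λ g → F (inject₁ c VF.∷ inject₁ ∘ g)))
      ≡⟨ sum-cong-≗ {k} (λ c → sumFun-cong m k (λ g → ext _ _ (λ { zero → refl ; (suc i) → refl }))) ⟩
    sum (λ c → sumFun m k (λ g → F (inject₁ ∘ (c VF.∷ g))))
      ∎
    where open ≡-Reasoning

  count : ∀ {A : Set} {P : A → Set} → Decidable P → List A → ℕ
  count P? xs = length (filter P? xs)

  count-∷ : ∀ {A : Set} {P : A → Set} (P? : Decidable P) x xs → count P? (x ∷ xs) ≡ indicator (P? x) + count P? xs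
  count-∷ P? x xs with P? x
  ... | yes _ = refl
  ... | no _  = refl

  count-++ : ∀ {A : Set} {P : A → Set} (P? : Decidable P) xs ys → count P? (xs ++ ys) ≡ count P? xs + count P? ys
  count-++ P? xs ys = trans (cong length (ListP.filter-++ P? xs ys)) (ListP.length-++ (filter P? xs))

  count-map : ∀ {A B : Set} {P : B → Set} (P? : Decidable P) (f : A → B) xs → count P? (map f xs) ≡ count (P? ∘ f) xs
  count-map P? f []       = refl
  count-map P? f (x ∷ xs) = trans (count-∷ P? (f x) (map f xs))
                                  (trans (cong (λ n → indicator (P? (f x)) + n) (count-map P? f xs)) (sym (count-∷ (P? ∘ f) x xs)))

  count-concatMap-tabulate : ∀ {A B : Set} {P : B → Set} (P? : Decidable P) k (t : Fin k → A) (h : A → List B) →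
    count P? (concatMap h (tabulate t)) ≡ sum (λ i → count P? (h (t i)))
  count-concatMap-tabulate P? zero    t h = refl
  count-concatMap-tabulate P? (suc k) t h =
    trans (count-++ P? (h (t zero)) _) (cong (λ n → count P? (h (t zero)) + n) (count-concatMap-tabulate P? k (t ∘ suc) h))

  count-allFuns : ∀ m k {P : (Fin m → Fin k) → Set} (P? : Decidable P) →
    count P? (allFuns m k) ≡ sumFun m k (indicator ∘ P?)
  count-allFuns zero    k P? = trans (count-∷ P? _ []) (ℕP.+-identityʳ _)
  count-allFuns (suc m) k P? =
    trans (count-concatMap-tabulate P? k id (λ c → map (c VF.∷_) (allFuns m k)))
          (sum-cong-≗ {k} (λ c → trans (count-map P? (c VF.∷_) (allFuns m k)) (count-allFuns m k (P? ∘ (c VF.∷_)))))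

  inject₁-or-last : ∀ {m} (v : Fin (suc m)) → (∃ λ i → v ≡ inject₁ i) ⊎ v ≡ fromℕ m
  inject₁-or-last {zero}  zero    = inj₂ refl
  inject₁-or-last {suc m} zero    = inj₁ (zero , refl)
  inject₁-or-last {suc m} (suc v) with inject₁-or-last v
  ... | inj₁ (i , v≡i) = inj₁ (suc i , cong suc v≡i)
  ... | inj₂ v≡last   = inj₂ (cong suc v≡last)

  inject₁<fromℕ : ∀ {m} (i : Fin m) → inject₁ i Fin.< fromℕ m
  inject₁<fromℕ {m} i = subst₂ ℕ._<_ (sym (FinP.toℕ-inject₁ i)) (sym (FinP.toℕ-fromℕ m)) (FinP.toℕ<n i)

  indicator-⊎ : ∀ {P Q R : Set} (p : Dec P) (q : Dec Q) (r : Dec R) →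
    (R → P ⊎ Q) → (P → R) → (Q → R) → ¬ (P × Q) → indicator r ≡ indicator p + indicator q
  indicator-⊎ (yes p) (yes q) r _ _ _ disjoint = ⊥-elim (disjoint (p , q))
  indicator-⊎ (yes p) (no _)  r _ f _ _        = indicator-yes r (f p)
  indicator-⊎ (no _)  (yes q) r _ _ g _        = indicator-yes r (g q)
  indicator-⊎ (no ¬p) (no ¬q) r split _ _ _    = indicator-no r ([ ¬p , ¬q ] ∘ split)

  indicator-¬ : ∀ {P : Set} (p : Dec P) → indicator (¬? p) + indicator p ≡ 1
  indicator-¬ (yes _) = refl
  indicator-¬ (no _)  = refl

  module _ {K : ℕ} where

    ImageOn : ∀ {m} → (Fin m → Set) → (Fin m → Fin K) → Fin K → Set
    ImageOn N g x = ∃ λ i → N i × g i ≡ x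

    imageOn? : ∀ {m} {N : Fin m → Set} → (∀ i → Dec (N i)) → ∀ g x → Dec (ImageOn N g x)
    imageOn? N? g x = FinP.any? (λ i → N? i ×-dec (g i FinP.≟ x))

    count-image : ∀ m {N : Fin m → Set} (N? : ∀ i → Dec (N i)) (g : Fin m → Fin K) →
      (∀ i j → N i → N j → g i ≡ g j → i ≡ j) →
      sum (λ x → indicator (imageOn? N? g x)) ≡ sum (λ i → indicator (N? i))
    count-image zero    N? g _   = sum-zero _ (λ x → indicator-no (imageOn? N? g x) (λ { (() , _) }))
    count-image (suc m) {N} N? g inj = begin
      sum (λ x → indicator (imageOn? N? g x))
        ≡⟨ sum-cong-≗ {K} split ⟩
      sum (λ x → indicator (first x) + indicator (imageOn? (N? ∘ suc) (g ∘ suc) x))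
        ≡⟨ ∑-distrib-+ {K} _ _ ⟩
      sum (λ x → indicator (first x)) + sum (λ x → indicator (imageOn? (N? ∘ suc) (g ∘ suc) x))
        ≡⟨ cong₂ _+_ first-count
                     (count-image m (N? ∘ suc) (g ∘ suc) (λ i j nᵢ nⱼ → FinP.suc-injective ∘ inj _ _ nᵢ nⱼ)) ⟩
      indicator (N? zero) + sum (λ i → indicator (N? (suc i)))
        ∎
      where
      open ≡-Reasoning
      first : ∀ x → Dec (N zero × g zero ≡ x)
      first x = N? zero ×-dec (g zero FinP.≟ x)
      split : ∀ x → indicator (imageOn? N? g x) ≡ indicator (first x) + indicator (imageOn? (N? ∘ suc) (g ∘ suc) x)
      split x = indicator-⊎ (first x) (imageOn? (N? ∘ suc) (g ∘ suc) x) (imageOn? N? g x)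
        (λ { (zero , hit) → inj₁ hit ; (suc i , hit) → inj₂ (i , hit) })
        (zero ,_)
        (λ { (i , hit) → suc i , hit })
        (λ { ((n₀ , g₀≡x) , (i , nᵢ , gᵢ≡x)) → FinP.0≢1+n (inj zero (suc i) n₀ nᵢ (trans g₀≡x (sym gᵢ≡x))) })
      first-count : sum (λ x → indicator (first x)) ≡ indicator (N? zero)
      first-count = trans (sum-single _ (g zero) (λ x x≢g₀ → indicator-no (first x) (λ (_ , g₀≡x) → x≢g₀ (sym g₀≡x))))
                          (indicator-cong _ _ proj₁ (_, refl))

  deleteLast : ∀ {m} → SimpleGraph (suc m) → SimpleGraph m
  deleteLast H = record
    { Adj    = λ a b → Adj H (inject₁ a) (inject₁ b)
    ; adj?   = λ a b → adj? H (inject₁ a) (inject₁ b)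
    ; sym    = adj-sym H
    ; irrefl = irrefl H
    }

  EarlierNeighbour : ∀ {m} → SimpleGraph (suc m) → Fin m → Set
  EarlierNeighbour {m} H i = Adj H (inject₁ i) (fromℕ m)

  earlierDegree : ∀ {m} → SimpleGraph (suc m) → ℕ
  earlierDegree {m} H = sum (λ i → indicator (adj? H (inject₁ i) (fromℕ m)))

  EarlierNeighboursFormClique : ∀ {m} → SimpleGraph (suc m) → Set
  EarlierNeighboursFormClique H =
    ∀ i j → i ≢ j → EarlierNeighbour H i → EarlierNeighbour H j → Adj H (inject₁ i) (inject₁ j)

  Image : ∀ {m K} → (Fin m → Fin K) → Fin K → Set
  Image g c = ∃ λ i → g i ≡ c

  Surjective : ∀ {m K} → (Fin m → Fin K) → Set
  Surjective g = ∀ c → Image g c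

  surjective? : ∀ {m K} (g : Fin m → Fin K) → Dec (Surjective g)
  surjective? g = FinP.all? (λ c → FinP.any? (λ i → g i FinP.≟ c))

  -- IsIndepPartition H K g unfolds to Surjective g × IsProperRGF H g; the proofs below rely on this.
  IsProperRGF : ∀ {m K} → SimpleGraph m → (Fin m → Fin K) → Set
  IsProperRGF {m} {K} H g =
    (∀ (i j : Fin m) → Adj H i j → ¬ (g i ≡ g j)) ×
    (∀ (i : Fin m) (c : Fin K) → c Fin.< g i → ∃ λ (j : Fin m) → j Fin.< i × g j ≡ c)

  isProperRGF? : ∀ {m K} (H : SimpleGraph m) (g : Fin m → Fin K) → Dec (IsProperRGF H g)
  isProperRGF? H g =
    FinP.all? (λ i → FinP.all? (λ j → adj? H i j →-dec ¬? (g i FinP.≟ g j))) ×-dec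
    FinP.all? (λ i → FinP.all? (λ c → (c Fin.<? g i) →-dec FinP.any? (λ j → (j Fin.<? i) ×-dec (g j FinP.≟ c))))

  isProperRGF-cong : ∀ {m K} (H : SimpleGraph m) {f g : Fin m → Fin K} → (∀ i → f i ≡ g i) →
                     IsProperRGF H f → IsProperRGF H g
  isProperRGF-cong H f≗g (indep , rgf) =
    (λ i j adj gᵢ≡gⱼ → indep i j adj (trans (f≗g i) (trans gᵢ≡gⱼ (sym (f≗g j))))) ,
    (λ i c c<gᵢ → let (j , j<i , fⱼ≡c) = rgf i c (subst (c Fin.<_) (sym (f≗g i)) c<gᵢ)
                  in j , j<i , trans (sym (f≗g j)) fⱼ≡c)

  isIndepPartition-cong : ∀ {m} (H : SimpleGraph m) K {f g : Fin m → Fin K} → (∀ i → f i ≡ g i) →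
                          IsIndepPartition H K f → IsIndepPartition H K g
  isIndepPartition-cong H K f≗g (surj , proper) =
    (λ c → let (i , fᵢ≡c) = surj c in i , trans (sym (f≗g i)) fᵢ≡c) , isProperRGF-cong H f≗g proper

  isIndepPartition-extensional : ∀ {m} (H : SimpleGraph m) K → Extensional (indicator ∘ isIndepPartition? H K)
  isIndepPartition-extensional H K f g f≗g =
    indicator-cong _ _ (isIndepPartition-cong H K f≗g) (isIndepPartition-cong H K (sym ∘ f≗g))

  stirlingG-cong : ∀ {m} (H₁ H₂ : SimpleGraph m) →
                   (∀ a b → Adj H₂ a b → Adj H₁ a b) → (∀ a b → Adj H₁ a b → Adj H₂ a b) →
                   ∀ k → stirlingG H₁ k ≡ stirlingG H₂ k
  stirlingG-cong {m} H₁ H₂ 2⇒1 1⇒2 k = begin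
    stirlingG H₁ k                                  ≡⟨ count-allFuns m k (isIndepPartition? H₁ k) ⟩
    sumFun m k (indicator ∘ isIndepPartition? H₁ k)  ≡⟨ sumFun-cong m k (λ g →
                                                          indicator-cong _ _ (fewer-edges {H₁} {H₂} 2⇒1)
                                                                             (fewer-edges {H₂} {H₁} 1⇒2)) ⟩
    sumFun m k (indicator ∘ isIndepPartition? H₂ k)  ≡⟨ sym (count-allFuns m k (isIndepPartition? H₂ k)) ⟩
    stirlingG H₂ k                                  ∎
    where
    open ≡-Reasoning
    fewer-edges : ∀ {A B : SimpleGraph m} {g} → (∀ a b → Adj B a b → Adj A a b) →
                  IsIndepPartition A k g → IsIndepPartition B k g
    fewer-edges B⇒A (surj , indep , rgf) = surj , (λ i j → indep i j ∘ B⇒A i j) , rgf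

  module DeleteLast {m : ℕ} (H′ : SimpleGraph (suc m)) (k : ℕ) where

    H : SimpleGraph m
    H = deleteLast H′

    last : Fin (suc m)
    last = fromℕ m

    top : Fin (suc k)
    top = fromℕ k

    AvoidsNeighbours : (Fin m → Fin (suc k)) → Fin (suc k) → Set
    AvoidsNeighbours g x = ∀ i → EarlierNeighbour H′ i → g i ≢ x

    module _ (g : Fin m → Fin (suc k)) (x : Fin (suc k)) where

      snoc-view : ∀ v → (∃ λ i → v ≡ inject₁ i × snoc g x v ≡ g i) ⊎ (v ≡ last × snoc g x v ≡ x)
      snoc-view v with inject₁-or-last v
      ... | inj₁ (i , refl) = inj₁ (i , refl , snoc-inject₁ g x i)
      ... | inj₂ refl       = inj₂ (refl , snoc-last g x)

      Extends : Set
      Extends = IsIndepPartition H′ (suc k) (snoc g x)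

      extends⇒proper : Extends → IsProperRGF H g
      extends⇒proper (_ , indep , rgf) =
        (λ i j adj gᵢ≡gⱼ → indep (inject₁ i) (inject₁ j) adj
                             (trans (snoc-inject₁ g x i) (trans gᵢ≡gⱼ (sym (snoc-inject₁ g x j))))) ,
        rgf′
        where
        rgf′ : ∀ i c → c Fin.< g i → ∃ λ j → j Fin.< i × g j ≡ c
        rgf′ i c c<gᵢ with rgf (inject₁ i) c (subst (c Fin.<_) (sym (snoc-inject₁ g x i)) c<gᵢ)
        ... | v , v<i , snoc≡c with snoc-view v
        ...   | inj₁ (j , refl , snoc≡gⱼ) =
          j , subst₂ ℕ._<_ (FinP.toℕ-inject₁ j) (FinP.toℕ-inject₁ i) v<i , trans (sym snoc≡gⱼ) snoc≡c
        ...   | inj₂ (refl , _) = ⊥-elim (ℕP.<-asym v<i (inject₁<fromℕ i))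

      extends⇒avoids : Extends → AvoidsNeighbours g x
      extends⇒avoids (_ , indep , _) i adj gᵢ≡x =
        indep (inject₁ i) last adj (trans (snoc-inject₁ g x i) (trans gᵢ≡x (sym (snoc-last g x))))

      extends⇒covers : Extends → ∀ c → c ≡ x ⊎ Image g c
      extends⇒covers (surj , _) c with surj c
      ... | v , snoc≡c with snoc-view v
      ...   | inj₁ (j , refl , snoc≡gⱼ) = inj₂ (j , trans (sym snoc≡gⱼ) snoc≡c)
      ...   | inj₂ (refl , snoc≡x)      = inj₁ (trans (sym snoc≡c) snoc≡x)

      extends : IsProperRGF H g → AvoidsNeighbours g x → (∀ c → c Fin.< x → Image g c) →
                (∀ c → c ≡ x ⊎ Image g c) → Extends
      extends (indep , rgf) avoids below-used covers = surj , indep′ , rgf′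
        where
        surj : ∀ c → Image (snoc g x) c
        surj c with covers c
        ... | inj₁ c≡x         = last , trans (snoc-last g x) (sym c≡x)
        ... | inj₂ (j , gⱼ≡c) = inject₁ j , trans (snoc-inject₁ g x j) gⱼ≡c
        indep′ : ∀ u v → Adj H′ u v → snoc g x u ≢ snoc g x v
        indep′ u v adj snocᵤ≡snocᵥ with snoc-view u | snoc-view v
        ... | inj₁ (i , refl , eᵢ) | inj₁ (j , refl , eⱼ) = indep i j adj (trans (sym eᵢ) (trans snocᵤ≡snocᵥ eⱼ))
        ... | inj₁ (i , refl , eᵢ) | inj₂ (refl , eₓ)     = avoids i adj (trans (sym eᵢ) (trans snocᵤ≡snocᵥ eₓ))
        ... | inj₂ (refl , eₓ)     | inj₁ (j , refl , eⱼ) =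
          avoids j (adj-sym H′ adj) (trans (sym eⱼ) (trans (sym snocᵤ≡snocᵥ) eₓ))
        ... | inj₂ (refl , _)      | inj₂ (refl , _)      = irrefl H′ adj
        rgf′ : ∀ u c → c Fin.< snoc g x u → ∃ λ v → v Fin.< u × snoc g x v ≡ c
        rgf′ u c c<snoc with snoc-view u
        ... | inj₁ (i , refl , eᵢ) =
          let (j , j<i , gⱼ≡c) = rgf i c (subst (c Fin.<_) eᵢ c<snoc)
          in inject₁ j , subst₂ ℕ._<_ (sym (FinP.toℕ-inject₁ j)) (sym (FinP.toℕ-inject₁ i)) j<i ,
             trans (snoc-inject₁ g x j) gⱼ≡c
        ... | inj₂ (refl , eₓ) =
          let (j , gⱼ≡c) = below-used c (subst (c Fin.<_) eₓ c<snoc)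
          in inject₁ j , inject₁<fromℕ j , trans (snoc-inject₁ g x j) gⱼ≡c

    extends? : ∀ g x → Dec (Extends g x)
    extends? g x = isIndepPartition? H′ (suc k) (snoc g x)

    PartitionBelowTop : (Fin m → Fin (suc k)) → Set
    PartitionBelowTop g = IsProperRGF H g × (∀ (c : Fin k) → Image g (inject₁ c)) × (∀ i → g i ≢ top)

    partitionBelowTop? : ∀ g → Dec (PartitionBelowTop g)
    partitionBelowTop? g = isProperRGF? H g ×-dec
      (FinP.all? (λ c → FinP.any? (λ i → g i FinP.≟ inject₁ c)) ×-dec FinP.all? (λ i → ¬? (g i FinP.≟ top)))

    partitionBelowTop-cong : ∀ {f g} → (∀ i → f i ≡ g i) → PartitionBelowTop f → PartitionBelowTop g
    partitionBelowTop-cong f≗g (proper , hits , avoids) =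
      isProperRGF-cong H f≗g proper ,
      (λ c → let (i , fᵢ≡c) = hits c in i , trans (sym (f≗g i)) fᵢ≡c) ,
      (λ i gᵢ≡top → avoids i (trans (f≗g i) gᵢ≡top))

    partitionBelowTop-inject₁ : ∀ (g : Fin m → Fin k) → PartitionBelowTop (inject₁ ∘ g) → IsIndepPartition H k g
    partitionBelowTop-inject₁ g ((indep , rgf) , hits , _) =
      (λ c → let (i , gᵢ≡c) = hits c in i , FinP.inject₁-injective gᵢ≡c) ,
      (λ i j adj gᵢ≡gⱼ → indep i j adj (cong inject₁ gᵢ≡gⱼ)) ,
      (λ i c c<gᵢ → let (j , j<i , gⱼ≡c) = rgf i (inject₁ c) (subst₂ ℕ._<_ (sym (FinP.toℕ-inject₁ c))
                                                                            (sym (FinP.toℕ-inject₁ (g i))) c<gᵢ)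
                    in j , j<i , FinP.inject₁-injective gⱼ≡c)

    inject₁-partitionBelowTop : ∀ (g : Fin m → Fin k) → IsIndepPartition H k g → PartitionBelowTop (inject₁ ∘ g)
    inject₁-partitionBelowTop g (surj , indep , rgf) =
      ((λ i j adj gᵢ≡gⱼ → indep i j adj (FinP.inject₁-injective gᵢ≡gⱼ)) , rgf′) ,
      (λ c → let (i , gᵢ≡c) = surj c in i , cong inject₁ gᵢ≡c) ,
      (λ i gᵢ≡top → FinP.fromℕ≢inject₁ (sym gᵢ≡top))
      where
      rgf′ : ∀ i c → c Fin.< inject₁ (g i) → ∃ λ j → j Fin.< i × inject₁ (g j) ≡ c
      rgf′ i c c<gᵢ with inject₁-or-last c
      ... | inj₁ (c′ , refl) =
        let (j , j<i , gⱼ≡c′) = rgf i c′ (subst₂ ℕ._<_ (FinP.toℕ-inject₁ c′) (FinP.toℕ-inject₁ (g i)) c<gᵢ)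
        in j , j<i , cong inject₁ gⱼ≡c′
      ... | inj₂ refl = ⊥-elim (ℕP.<-asym c<gᵢ (inject₁<fromℕ (g i)))

    extensions-of-improper : ∀ g → ¬ IsProperRGF H g → sum (λ x → indicator (extends? g x)) ≡ 0
    extensions-of-improper g improper =
      sum-zero _ (λ x → indicator-no (extends? g x) (improper ∘ extends⇒proper g x))

    extensions-of-surjective : EarlierNeighboursFormClique H′ → ∀ g → IsProperRGF H g → Surjective g →
      sum (λ x → indicator (extends? g x)) + earlierDegree H′ ≡ suc k
    extensions-of-surjective clique g proper surj = begin
      sum (λ x → indicator (extends? g x)) + earlierDegree H′
        ≡⟨ cong₂ _+_ (sum-cong-≗ {suc k} extends⇔avoids) (sym neighbour-labels) ⟩
      sum (λ x → indicator (¬? (neighbour-label? x))) + sum (λ x → indicator (neighbour-label? x))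
        ≡⟨ sym (∑-distrib-+ (indicator ∘ ¬? ∘ neighbour-label?) (indicator ∘ neighbour-label?)) ⟩
      sum (λ x → indicator (¬? (neighbour-label? x)) + indicator (neighbour-label? x))
        ≡⟨ sum-cong-≗ {suc k} (λ x → indicator-¬ (neighbour-label? x)) ⟩
      sum {suc k} (λ _ → 1)
        ≡⟨ sum-ones (suc k) ⟩
      suc k
        ∎
      where
      open ≡-Reasoning
      neighbour-label? : ∀ x → Dec (ImageOn (EarlierNeighbour H′) g x)
      neighbour-label? = imageOn? (λ i → adj? H′ (inject₁ i) last) g
      -- Earlier neighbours are pairwise adjacent, so a proper colouring gives them distinct labels.
      labels-injective : ∀ i j → EarlierNeighbour H′ i → EarlierNeighbour H′ j → g i ≡ g j → i ≡ j
      labels-injective i j nᵢ nⱼ gᵢ≡gⱼ with i FinP.≟ j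
      ... | yes i≡j = i≡j
      ... | no i≢j  = ⊥-elim (proj₁ proper i j (clique i j i≢j nᵢ nⱼ) gᵢ≡gⱼ)
      neighbour-labels : sum (λ x → indicator (neighbour-label? x)) ≡ earlierDegree H′
      neighbour-labels = count-image m _ g labels-injective
      extends⇔avoids : ∀ x → indicator (extends? g x) ≡ indicator (¬? (neighbour-label? x))
      extends⇔avoids x = indicator-cong _ _
        (λ ext (i , nᵢ , gᵢ≡x) → extends⇒avoids g x ext i nᵢ gᵢ≡x)
        (λ ¬label → extends g x proper (λ i nᵢ gᵢ≡x → ¬label (i , nᵢ , gᵢ≡x)) (λ c _ → surj c) (inj₂ ∘ surj))

    -- If g misses a label, the new vertex must open the missing block, which can only be the top label.
    extensions-of-nonsurjective : ∀ g → IsProperRGF H g → ¬ Surjective g →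
      sum (λ x → indicator (extends? g x)) ≡ indicator (partitionBelowTop? g)
    extensions-of-nonsurjective g proper ¬surj =
      trans (sum-cong-≗ {suc k} extends⇔top)
            (trans (sum-single _ top (λ x x≢top → indicator-no (x FinP.≟ top ×-dec partitionBelowTop? g) (x≢top ∘ proj₁)))
                   (indicator-cong _ _ proj₂ (refl ,_)))
      where
      forward : ∀ x → Extends g x → x ≡ top × PartitionBelowTop g
      forward x ext = x≡top , proper , hits , λ i gᵢ≡top → x-unused (i , trans gᵢ≡top (sym x≡top))
        where
        x-unused : ¬ Image g x
        x-unused (j , gⱼ≡x) =
          ¬surj λ c → [ (λ c≡x → j , trans gⱼ≡x (sym c≡x)) , (λ hit → hit) ] (extends⇒covers g x ext c)
        x≡top : x ≡ top
        x≡top with x FinP.≟ top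
        ... | yes x≡top = x≡top
        ... | no x≢top with extends⇒covers g x ext top
        ...   | inj₁ top≡x        = sym top≡x
        ...   | inj₂ (j , gⱼ≡top) =
          let x<top = FinP.≤∧≢⇒< (FinP.≤fromℕ x) x≢top
              (j′ , _ , gⱼ′≡x) = proj₂ proper j x (subst (x Fin.<_) (sym gⱼ≡top) x<top)
          in ⊥-elim (x-unused (j′ , gⱼ′≡x))
        hits : ∀ (c : Fin k) → Image g (inject₁ c)
        hits c with extends⇒covers g x ext (inject₁ c)
        ... | inj₁ c≡x = ⊥-elim (FinP.fromℕ≢inject₁ (sym (trans c≡x x≡top)))
        ... | inj₂ hit = hit
      backward : ∀ x → x ≡ top × PartitionBelowTop g → Extends g x
      backward x (refl , _ , hits , avoids-top) = extends g x proper (λ i _ → avoids-top i) below-used covers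
        where
        below-used : ∀ c → c Fin.< x → Image g c
        below-used c c<x with inject₁-or-last c
        ... | inj₁ (c′ , refl) = hits c′
        ... | inj₂ refl        = ⊥-elim (ℕP.<-irrefl refl c<x)
        covers : ∀ c → c ≡ x ⊎ Image g c
        covers c with inject₁-or-last c
        ... | inj₁ (c′ , refl) = inj₂ (hits c′)
        ... | inj₂ c≡top       = inj₁ c≡top
      extends⇔top : ∀ x → indicator (extends? g x) ≡ indicator (x FinP.≟ top ×-dec partitionBelowTop? g)
      extends⇔top x = indicator-cong _ _ (forward x) (backward x)

    extensions-count : EarlierNeighboursFormClique H′ → ∀ g →
      sum (λ x → indicator (extends? g x)) + earlierDegree H′ * indicator (isIndepPartition? H (suc k) g)
        ≡ suc k * indicator (isIndepPartition? H (suc k) g) + indicator (partitionBelowTop? g)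
    extensions-count clique g = by-cases (isProperRGF? H g) (surjective? g)
      where
      by-cases : Dec (IsProperRGF H g) → Dec (Surjective g) →
        sum (λ x → indicator (extends? g x)) + earlierDegree H′ * indicator (isIndepPartition? H (suc k) g)
          ≡ suc k * indicator (isIndepPartition? H (suc k) g) + indicator (partitionBelowTop? g)
      by-cases (no improper) _
        rewrite extensions-of-improper g improper
              | indicator-no (isIndepPartition? H (suc k) g) (improper ∘ proj₂)
              | indicator-no (partitionBelowTop? g) (improper ∘ proj₁)
              | ℕP.*-zeroʳ (earlierDegree H′) | ℕP.*-zeroʳ k = refl
      by-cases (yes proper) (yes surj)
        rewrite indicator-yes (isIndepPartition? H (suc k) g) (surj , proper)
              | indicator-no (partitionBelowTop? g) (λ (_ , _ , avoids-top) → let (i , gᵢ≡top) = surj top in avoids-top i gᵢ≡top)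
              | ℕP.*-identityʳ (earlierDegree H′) | ℕP.*-identityʳ k | ℕP.+-identityʳ k
        = extensions-of-surjective clique g proper surj
      by-cases (yes proper) (no ¬surj)
        rewrite indicator-no (isIndepPartition? H (suc k) g) (¬surj ∘ proj₁)
              | ℕP.*-zeroʳ (earlierDegree H′) | ℕP.*-zeroʳ k | ℕP.+-identityʳ (sum (λ x → indicator (extends? g x)))
        = extensions-of-nonsurjective g proper ¬surj

    stirlingG-recurrence : EarlierNeighboursFormClique H′ →
      stirlingG H′ (suc k) + earlierDegree H′ * stirlingG H (suc k) ≡ suc k * stirlingG H (suc k) + stirlingG H k
    stirlingG-recurrence clique = begin
      stirlingG H′ (suc k) + earlierDegree H′ * stirlingG H (suc k)
        ≡⟨ cong₂ (λ a b → a + earlierDegree H′ * b) (count-allFuns (suc m) (suc k) (isIndepPartition? H′ (suc k)))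
                                                    (count-allFuns m (suc k) (isIndepPartition? H (suc k))) ⟩
      sumFun (suc m) (suc k) [ H′ ] + earlierDegree H′ * sumFun m (suc k) [ H ]
        ≡⟨ cong₂ _+_ (sumFun-snoc m (suc k) [ H′ ] (isIndepPartition-extensional H′ (suc k)))
                     (sym (sumFun-*ˡ m (suc k) (earlierDegree H′) [ H ])) ⟩
      sumFun m (suc k) (λ g → sum (λ x → indicator (extends? g x))) + sumFun m (suc k) (λ g → earlierDegree H′ * [ H ] g)
        ≡⟨ sym (sumFun-distrib-+ m (suc k) _ _) ⟩
      sumFun m (suc k) (λ g → sum (λ x → indicator (extends? g x)) + earlierDegree H′ * [ H ] g)
        ≡⟨ sumFun-cong m (suc k) (extensions-count clique) ⟩
      sumFun m (suc k) (λ g → suc k * [ H ] g + indicator (partitionBelowTop? g))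
        ≡⟨ sumFun-distrib-+ m (suc k) _ _ ⟩
      sumFun m (suc k) (λ g → suc k * [ H ] g) + sumFun m (suc k) (indicator ∘ partitionBelowTop?)
        ≡⟨ cong₂ _+_ (sumFun-*ˡ m (suc k) (suc k) [ H ]) below-top ⟩
      suc k * sumFun m (suc k) [ H ] + sumFun m k (indicator ∘ isIndepPartition? H k)
        ≡⟨ sym (cong₂ (λ a b → suc k * a + b) (count-allFuns m (suc k) (isIndepPartition? H (suc k)))
                                              (count-allFuns m k (isIndepPartition? H k))) ⟩
      suc k * stirlingG H (suc k) + stirlingG H k
        ∎
      where
      open ≡-Reasoning
      [_] : ∀ {n} → SimpleGraph n → (Fin n → Fin (suc k)) → ℕ
      [ G ] = indicator ∘ isIndepPartition? G (suc k)
      below-top : sumFun m (suc k) (indicator ∘ partitionBelowTop?) ≡ sumFun m k (indicator ∘ isIndepPartition? H k)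
      below-top = trans
        (sumFun-narrow m k _ (λ f g f≗g → indicator-cong _ _ (partitionBelowTop-cong f≗g) (partitionBelowTop-cong (sym ∘ f≗g)))
                             (λ g i gᵢ≡top → indicator-no (partitionBelowTop? g)
                                                            (λ (_ , _ , avoids-top) → avoids-top i gᵢ≡top)))
        (sumFun-cong m k (λ g → indicator-cong _ _ (partitionBelowTop-inject₁ g) (inject₁-partitionBelowTop g)))

open Counting

module PerfectElimination where

  open import Data.Nat using (_+_; _*_)
  open SemiringSum ℕP.+-*-semiring using (sum; sum-cong-≗; sum-init-last)

  recurrence-in-ℤ : ∀ {x a b K d : ℕ} → x + d * b ≡ K * b + a → + x ≡ + a ℤ.+ (+ K - + d) ℤ.* + b
  recurrence-in-ℤ {x} {a} {b} {K} {d} eq = begin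
    + x                                         ≡⟨ add-sub (+ x) (+ d ℤ.* + b) ⟩
    + x ℤ.+ + d ℤ.* + b - + d ℤ.* + b           ≡⟨ cong (_- + d ℤ.* + b) (sym (pos-linear x d b)) ⟩
    + (x + d * b) - + d ℤ.* + b                 ≡⟨ cong (λ z → + z - + d ℤ.* + b) eq ⟩
    + (K * b + a) - + d ℤ.* + b                 ≡⟨ cong (_- + d ℤ.* + b)
                                                         (trans (cong +_ (ℕP.+-comm (K * b) a)) (pos-linear a K b)) ⟩
    + a ℤ.+ + K ℤ.* + b - + d ℤ.* + b           ≡⟨ collect (+ a) (+ K) (+ d) (+ b) ⟩
    + a ℤ.+ (+ K - + d) ℤ.* + b                 ∎
    where
    open ≡-Reasoning
    pos-linear : ∀ x d b → + (x + d * b) ≡ + x ℤ.+ + d ℤ.* + b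
    pos-linear x d b = trans (ℤP.pos-+ x (d * b)) (cong (λ z → + x ℤ.+ z) (ℤP.pos-* d b))
    add-sub : ∀ x y → x ≡ x ℤ.+ y - y
    add-sub = solve-∀
    collect : ∀ a K d b → a ℤ.+ K ℤ.* b - d ℤ.* b ≡ a ℤ.+ (K - d) ℤ.* b
    collect = solve-∀

  Σ< : ℕ → (ℕ → ℕ) → ℕ
  Σ< zero    f = 0
  Σ< (suc t) f = Σ< t f + f t

  Σ<-mono : ∀ t (f g : ℕ → ℕ) → (∀ i → i ℕ.< t → f i ℕ.≤ g i) → Σ< t f ℕ.≤ Σ< t g
  Σ<-mono zero    f g f≤g = ℕ.z≤n
  Σ<-mono (suc t) f g f≤g = ℕP.+-mono-≤ (Σ<-mono t f g (λ i i<t → f≤g i (ℕP.m<n⇒m<1+n i<t))) (f≤g t (ℕP.n<1+n t))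

  sum-toℕ : ∀ M (f : ℕ → ℕ) → sum {M} (f ∘ toℕ) ≡ Σ< M f
  sum-toℕ zero    f = refl
  sum-toℕ (suc M) f = begin
    sum {suc M} (f ∘ toℕ)                              ≡⟨ sum-init-last (f ∘ toℕ) ⟩
    sum {M} (f ∘ toℕ ∘ inject₁) + f (toℕ (fromℕ M))    ≡⟨ cong₂ _+_ (sum-cong-≗ {M} (cong f ∘ FinP.toℕ-inject₁))
                                                                    (cong f (FinP.toℕ-fromℕ M)) ⟩
    sum {M} (f ∘ toℕ) + f M                            ≡⟨ cong (_+ f M) (sum-toℕ M f) ⟩
    Σ< M f + f M                                       ∎
    where open ≡-Reasoning

  module _ {n : ℕ} (G : SimpleGraph n) where

    -- Adjacency of vertices given by their indices; false out of range, so cliqueSizes M = 0 for M ≥ n.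
    Adjacentℕ : ℕ → ℕ → Set
    Adjacentℕ i j = Σ (i ℕ.< n) λ i<n → Σ (j ℕ.< n) λ j<n → Adj G (fromℕ< i<n) (fromℕ< j<n)

    adjacentℕ? : ∀ i j → Dec (Adjacentℕ i j)
    adjacentℕ? i j with i ℕ.<? n | j ℕ.<? n
    ... | no i≮n  | _       = no (λ (i<n , _) → i≮n i<n)
    ... | yes _   | no j≮n  = no (λ (_ , j<n , _) → j≮n j<n)
    ... | yes i<n | yes j<n with adj? G (fromℕ< i<n) (fromℕ< j<n)
    ...   | yes adj = yes (i<n , j<n , adj)
    ...   | no ¬adj = no (λ (_ , _ , adj) → ¬adj adj)

    adjacentℕ-toℕ : ∀ {u v : Fin n} {i j} → toℕ u ≡ i → toℕ v ≡ j → Adj G u v → Adjacentℕ i j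
    adjacentℕ-toℕ {u} {v} refl refl adj =
      FinP.toℕ<n u , FinP.toℕ<n v , subst₂ (Adj G) (sym (FinP.fromℕ<-toℕ u _)) (sym (FinP.fromℕ<-toℕ v _)) adj

    toℕ-adjacentℕ : ∀ {u v : Fin n} {i j} → toℕ u ≡ i → toℕ v ≡ j → Adjacentℕ i j → Adj G u v
    toℕ-adjacentℕ {u} {v} refl refl (u<n , v<n , adj) = subst₂ (Adj G) (FinP.fromℕ<-toℕ u _) (FinP.fromℕ<-toℕ v _) adj

    earlierNeighbours : ℕ → ℕ
    earlierNeighbours M = Σ< M (λ i → indicator (adjacentℕ? i M))

    cliqueSizes : ℕ → ℤ
    cliqueSizes M = + earlierNeighbours M

    module _ {M : ℕ} (q : suc M ℕ.≤ n) where

      toℕ-inject≤-inject₁ : ∀ (i : Fin M) → toℕ (inject≤ (inject₁ i) q) ≡ toℕ i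
      toℕ-inject≤-inject₁ i = trans (FinP.toℕ-inject≤ (inject₁ i) q) (FinP.toℕ-inject₁ i)

      toℕ-inject≤-fromℕ : toℕ (inject≤ (fromℕ M) q) ≡ M
      toℕ-inject≤-fromℕ = trans (FinP.toℕ-inject≤ (fromℕ M) q) (FinP.toℕ-fromℕ M)

      earlierDegree-prefix : earlierDegree (inducedPrefix G (suc M) q) ≡ earlierNeighbours M
      earlierDegree-prefix = trans (sum-cong-≗ {M} same-indicator) (sum-toℕ M (λ i → indicator (adjacentℕ? i M)))
        where
        same-indicator : ∀ i → indicator (adj? (inducedPrefix G (suc M) q) (inject₁ i) (fromℕ M))
                             ≡ indicator (adjacentℕ? (toℕ i) M)
        same-indicator i = indicator-cong _ _ (adjacentℕ-toℕ (toℕ-inject≤-inject₁ i) toℕ-inject≤-fromℕ)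
                                              (toℕ-adjacentℕ (toℕ-inject≤-inject₁ i) toℕ-inject≤-fromℕ)

      stirlingG-deleteLast-prefix : ∀ k →
        stirlingG (deleteLast (inducedPrefix G (suc M) q)) k ≡ stirlingG (inducedPrefix G M (ℕP.<⇒≤ q)) k
      stirlingG-deleteLast-prefix = stirlingG-cong (deleteLast (inducedPrefix G (suc M) q)) (inducedPrefix G M (ℕP.<⇒≤ q))
        (λ a b → subst₂ (Adj G) (same-vertex a) (same-vertex b))
        (λ a b → subst₂ (Adj G) (sym (same-vertex a)) (sym (same-vertex b)))
        where
        same-vertex : ∀ a → inject≤ a (ℕP.<⇒≤ q) ≡ inject≤ (inject₁ a) q
        same-vertex a = FinP.toℕ-injective (trans (FinP.toℕ-inject≤ a _) (sym (toℕ-inject≤-inject₁ a)))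

    module _ (peo : IsPerfectEliminationOrder G) where

      prefix-earlierNeighboursFormClique : ∀ {M} (q : suc M ℕ.≤ n) → EarlierNeighboursFormClique (inducedPrefix G (suc M) q)
      prefix-earlierNeighboursFormClique {M} q i j i≢j i~last j~last =
        peo _ _ _ (earlier i) (earlier j) distinct (adj-sym G i~last) (adj-sym G j~last)
        where
        earlier : ∀ (a : Fin M) → inject≤ (inject₁ a) q Fin.< inject≤ (fromℕ M) q
        earlier a = subst₂ ℕ._<_ (sym (toℕ-inject≤-inject₁ q a)) (sym (toℕ-inject≤-fromℕ q)) (FinP.toℕ<n a)
        distinct : inject≤ (inject₁ i) q ≢ inject≤ (inject₁ j) q
        distinct eq = i≢j (FinP.toℕ-injective (trans (sym (toℕ-inject≤-inject₁ q i))
                                                     (trans (cong toℕ eq) (toℕ-inject≤-inject₁ q j))))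

      stirlingG-prefix : ∀ M (p : M ℕ.≤ n) k → + stirlingG (inducedPrefix G M p) k ≡ genStirling cliqueSizes M k
      stirlingG-prefix zero          p zero    = refl
      stirlingG-prefix zero          p (suc k) = refl
      stirlingG-prefix (suc zero)    p zero    = refl
      stirlingG-prefix (suc (suc M)) p zero    = sym (begin
        + 0 ℤ.+ (+ 0 - cliqueSizes (suc M)) ℤ.* genStirling cliqueSizes (suc M) 0
          ≡⟨ cong (λ s → + 0 ℤ.+ (+ 0 - cliqueSizes (suc M)) ℤ.* s) (sym (stirlingG-prefix (suc M) (ℕP.<⇒≤ p) 0)) ⟩
        + 0 ℤ.+ (+ 0 - cliqueSizes (suc M)) ℤ.* + 0
          ≡⟨ trans (ℤP.+-identityˡ _) (ℤP.*-zeroʳ (+ 0 - cliqueSizes (suc M))) ⟩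
        + 0 ∎)
        where open ≡-Reasoning
      stirlingG-prefix (suc M) p (suc k) = begin
        + stirlingG H′ (suc k)
          ≡⟨ recurrence-in-ℤ {a = s k} {b = s (suc k)} {K = suc k} {d = earlierDegree H′}
               (DeleteLast.stirlingG-recurrence H′ k (prefix-earlierNeighboursFormClique p)) ⟩
        + s k ℤ.+ (+ suc k - + earlierDegree H′) ℤ.* + s (suc k)
          ≡⟨ cong₂ (λ a b → a ℤ.+ (+ suc k - + earlierDegree H′) ℤ.* b) (previous k) (previous (suc k)) ⟩
        genStirling cliqueSizes M k ℤ.+ (+ suc k - + earlierDegree H′) ℤ.* genStirling cliqueSizes M (suc k)
          ≡⟨ cong (λ d → genStirling cliqueSizes M k ℤ.+ (+ suc k - + d) ℤ.* genStirling cliqueSizes M (suc k))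
                  (earlierDegree-prefix p) ⟩
        genStirling cliqueSizes (suc M) (suc k) ∎
        where
        open ≡-Reasoning
        H′ : SimpleGraph (suc M)
        H′ = inducedPrefix G (suc M) p
        s : ℕ → ℕ
        s = stirlingG (deleteLast H′)
        previous : ∀ j → + s j ≡ genStirling cliqueSizes M j
        previous j = trans (cong +_ (stirlingG-deleteLast-prefix p j)) (stirlingG-prefix M (ℕP.<⇒≤ p) j)

      -- Every earlier neighbour of M below its latest earlier neighbour j is, by the elimination order,
      -- a neighbour of j.
      latest-neighbour-bound : ∀ M t → t ℕ.≤ M →
        Σ< t (λ i → indicator (adjacentℕ? i M)) ≡ 0 ⊎
        ∃ λ j → j ℕ.< t × Σ< t (λ i → indicator (adjacentℕ? i M)) ℕ.≤ suc (earlierNeighbours j)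
      latest-neighbour-bound M zero    _     = inj₁ refl
      latest-neighbour-bound M (suc t) 1+t≤M with adjacentℕ? t M
      ... | no _ rewrite ℕP.+-identityʳ (Σ< t (λ i → indicator (adjacentℕ? i M)))
        with latest-neighbour-bound M t (ℕP.<⇒≤ 1+t≤M)
      ...   | inj₁ none             = inj₁ none
      ...   | inj₂ (j , j<t , bound) = inj₂ (j , ℕP.m<n⇒m<1+n j<t , bound)
      latest-neighbour-bound M (suc t) 1+t≤M | yes (t<n , M<n , t~M) =
        inj₂ (t , ℕP.n<1+n t , subst (ℕ._≤ suc (earlierNeighbours t)) (ℕP.+-comm 1 _) (ℕ.s≤s (Σ<-mono t _ _ λ i i<t →
          indicator-mono (adjacentℕ? i M) (adjacentℕ? i t) (neighbour-of-t i i<t))))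
        where
        neighbour-of-t : ∀ i → i ℕ.< t → Adjacentℕ i M → Adjacentℕ i t
        neighbour-of-t i i<t (i<n , _ , i~M) = i<n , t<n , adj-sym G (peo (fromℕ< M<n) (fromℕ< t<n) (fromℕ< i<n)
          (subst₂ ℕ._<_ (sym (FinP.toℕ-fromℕ< t<n)) (sym (FinP.toℕ-fromℕ< M<n)) 1+t≤M)
          (subst₂ ℕ._<_ (sym (FinP.toℕ-fromℕ< i<n)) (sym (FinP.toℕ-fromℕ< M<n)) (ℕP.<-trans i<t 1+t≤M))
          (λ t≡i → ℕP.<-irrefl (trans (sym (FinP.toℕ-fromℕ< i<n)) (trans (cong toℕ (sym t≡i)) (FinP.toℕ-fromℕ< t<n)))
                               i<t)
          (adj-sym G t~M) (adj-sym G i~M))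

      cliqueSizes-boundedGrowth : BoundedGrowth cliqueSizes
      cliqueSizes-boundedGrowth M with latest-neighbour-bound M M ℕP.≤-refl
      ... | inj₁ none             = inj₁ (ℤP.≤-reflexive (cong +_ none))
      ... | inj₂ (j , j<M , bound) = inj₂ (j , j<M , ℤ.+≤+ (subst (earlierNeighbours M ℕ.≤_) (ℕP.+-comm 1 _) bound))

open PerfectElimination

theorem2p2 : (n : ℕ) (G : SimpleGraph n) → IsPerfectEliminationOrder G →
    TotallyNonNegative (stirlingMatrix G)
theorem2p2 n G peo r ρ σ ρ↑ σ↑ =
  subst (+ 0 ℤ.≤_) (det-cong entries)
    (genStirling-totallyNonNegative (suc n) (cliqueSizes G) (cliqueSizes-boundedGrowth G peo)
                                    r (toℕ ∘ ρ) (toℕ ∘ σ) ρ↑ σ↑ (FinP.toℕ<n ∘ ρ))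
  where
  entries : ∀ a b → genStirling (cliqueSizes G) (toℕ (ρ a)) (toℕ (σ b)) ≡ stirlingMatrix G (ρ a) (σ b)
  entries a b = sym (stirlingG-prefix G peo (toℕ (ρ a)) (FinP.toℕ≤pred[n] (ρ a)) (toℕ (σ b)))
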